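{- Let $H$ be a graph with at least one edge. Then for all $n$ sufficiently large with respect to $H$, $$\mathcal{C}_H(K_n)=\begin{cases}\mathcal{C}(K_n) & \text{if } H \text{ is Eulerian and } |H| \text{ is odd},\\ \mathcal{C}(K_n)\cap\mathcal{D}(K_n) & \text{if } H \text{ is Eulerian and } |H| \text{ is even},\\ \mathcal{E}(K_n) & \text{if } H \text{ is not Eulerian and } |H| \text{ is odd},\\ \mathcal{D}(K_n) & \text{if } H \text{ is not Eulerian and } |H| \text{ is even}.\end{cases}$$
   Context: For a graph $G$, the edge space $\mathcal{E}(G)=\mathbb{F}_2^{E(G)}$ is identified with the set of spanning subgraphs (edge sets) of $G$, addition being symmetric difference. $\mathcal{C}(G)$ is the cycle space (subspace spanned by cycles of $G$); $\mathcal{C}_H(G)$ is the subspace spanned by the copies of $H$ in $G$; $\mathcal{D}(G)=\{D\in\mathcal{E}(G):|D|\equiv 0 \pmod 2\}$. $|H|$ denotes the number of edges of $H$. "Eulerian" means all degrees are even (the graph need not be connected). -}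

module Defs where

open import Data.Nat using (ℕ; zero; suc; _+_; _%_; _<ᵇ_)
open import Data.Bool using (Bool; true; false; _∧_; _∨_; _xor_; if_then_else_)
open import Data.Fin using (Fin; zero; suc; toℕ; inject₁; fromℕ; _≟_)
open import Data.List using (List; []; _∷_; foldr)
open import Data.List.Relation.Unary.All using (All)
open import Data.Product using (Σ; _×_; ∃; ∃-syntax)
open import Function.Definitions using (Injective)
open import Relation.Binary.PropositionalEquality using (_≡_)
open import Relation.Nullary.Decidable using (⌊_⌋)

anyFin : (k : ℕ) → (Fin k → Bool) → Bool
anyFin zero    f = false
anyFin (suc k) f = f zero ∨ anyFin k (λ t → f (suc t))

sumFin : (k : ℕ) → (Fin k → ℕ) → ℕ
sumFin zero    f = 0
sumFin (suc k) f = f zero + sumFin k (λ t → f (suc t))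

record Graph : Set where
  field
    V     : ℕ
    adj   : Fin V → Fin V → Bool
    sym   : ∀ u v → adj u v ≡ adj v u
    irref : ∀ u → adj u u ≡ false
open Graph public

numEdges : Graph → ℕ
numEdges H = sumFin (V H) λ u → sumFin (V H) λ v →
  if (toℕ u <ᵇ toℕ v) ∧ adj H u v then 1 else 0

degree : (H : Graph) → Fin (V H) → ℕ
degree H u = sumFin (V H) λ v → if adj H u v then 1 else 0

Eulerian : Graph → Set
Eulerian H = ∀ u → degree H u % 2 ≡ 0

HasEdge : Graph → Set
HasEdge H = ∃[ u ] ∃[ v ] adj H u v ≡ true

-- Edge space of K_n: an element is a function Fin n → Fin n → Bool of
-- which only the values at pairs (i , j) with toℕ i < toℕ j are relevant;
-- the pair encodes the edge ij of K_n.
EdgeSet : ℕ → Set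
EdgeSet n = Fin n → Fin n → Bool

_≈E_ : ∀ {n} → EdgeSet n → EdgeSet n → Set
_≈E_ {n} D D' = ∀ (i j : Fin n) → (toℕ i <ᵇ toℕ j) ≡ true → D i j ≡ D' i j

emptyE : ∀ {n} → EdgeSet n
emptyE i j = false

_⊕_ : ∀ {n} → EdgeSet n → EdgeSet n → EdgeSet n
(D ⊕ D') i j = D i j xor D' i j

sumE : ∀ {n} → List (EdgeSet n) → EdgeSet n
sumE = foldr _⊕_ emptyE

sizeE : ∀ {n} → EdgeSet n → ℕ
sizeE {n} D = sumFin n λ i → sumFin n λ j →
  if (toℕ i <ᵇ toℕ j) ∧ D i j then 1 else 0

InD : ∀ {n} → EdgeSet n → Set
InD D = sizeE D % 2 ≡ 0

InSpan : ∀ {n} → (EdgeSet n → Set) → EdgeSet n → Set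
InSpan {n} G D = Σ (List (EdgeSet n)) λ L → All G L × (sumE L ≈E D)

samePair : ∀ {n} → Fin n → Fin n → Fin n → Fin n → Bool
samePair a b i j = (⌊ a ≟ i ⌋ ∧ ⌊ b ≟ j ⌋) ∨ (⌊ a ≟ j ⌋ ∧ ⌊ b ≟ i ⌋)

copyOf : (H : Graph) → ∀ {n} → (Fin (V H) → Fin n) → EdgeSet n
copyOf H φ i j = anyFin (V H) λ u → anyFin (V H) λ v →
  adj H u v ∧ samePair (φ u) (φ v) i j

IsCopy : (H : Graph) → ∀ {n} → EdgeSet n → Set
IsCopy H {n} D = ∃[ φ ] Injective _≡_ _≡_ φ × (copyOf H φ ≈E D)

-- The cycle c 0, c 1, ..., c (k+2), c 0 of length k+3 in K_n.
cycleOf : ∀ {n} k → (Fin (suc (suc (suc k))) → Fin n) → EdgeSet n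
cycleOf k c i j =
  anyFin (suc (suc k)) (λ t → samePair (c (inject₁ t)) (c (suc t)) i j)
  ∨ samePair (c (fromℕ (suc (suc k)))) (c zero) i j

IsCycle : ∀ {n} → EdgeSet n → Set
IsCycle {n} D = ∃[ k ] ∃[ c ] Injective _≡_ _≡_ c × (cycleOf k c ≈E D)

InC : ∀ {n} → EdgeSet n → Set
InC = InSpan IsCycle

InCH : (H : Graph) → ∀ {n} → EdgeSet n → Set
InCH H = InSpan (IsCopy H)

-- Everything is linear algebra over F₂, and the span of the copies of H is invariant
-- under relabelling the vertices of Kₙ. Every copy of H has |H| edges and, if H is
-- Eulerian, only even degrees; sets with even degrees form the cycle space, spanned by
-- the triangles through one vertex. Conversely, if φ places an edge of H on aw and
-- avoids b and c, the copies φ, (ab)φ, (wc)φ and (ab)(wc)φ add up to the 4-cycle awbc,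
-- so C_H contains all 4-cycles and hence all sums of two triangles. If H has a vertex
-- of odd degree, a copy plus its image under (xz) plus suitable 4-cycles is the path
-- xyz, so C_H contains all sums of two edges. This leaves the parity of the number of
-- edges as the only further obstruction, and a single copy of H realises odd parity
-- exactly when |H| is odd.

module Submission where

open import Defs hiding (sym)
open import Data.Nat using (ℕ; zero; suc; _+_; _%_; _<ᵇ_; _≤_; _<_; _≥_; s≤s)
import Data.Nat.Properties as ℕ
open import Data.Bool using (Bool; true; false; _∧_; _∨_; _xor_; not; if_then_else_)
open import Data.Bool.Properties
  using (xor-assoc; xor-same; xor-identityʳ; ∧-comm; ∧-zeroʳ; ∧-identityʳ; ∧-distribˡ-xor; ∧-distribʳ-xor;
         ∨-comm; not-distribˡ-xor; not-involutive; not-¬; ¬-not; xor-∧-commutativeRing)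
open import Data.Empty using (⊥; ⊥-elim)
open import Data.Fin using (Fin; zero; suc; toℕ; _≟_; inject₁; fromℕ; inject≤; fromℕ<)
open import Data.Fin.Properties
  using (suc-injective; toℕ-inject₁; toℕ-fromℕ; inject₁-injective; toℕ<n;
         toℕ-inject≤; toℕ-fromℕ<; inject≤-injective; 0≢1+n; any?; ¬∀⟶∃¬)
open import Data.List using (List; []; _∷_; _++_)
open import Data.List.Relation.Unary.All using (All; []; _∷_)
open import Data.Maybe using (just; nothing)
open import Data.Product using (_×_; _,_; ∃-syntax; proj₁; proj₂)
open import Data.Sum using (_⊎_; inj₁; inj₂)
open import Data.Unit using (⊤; tt)
open import Function.Base using (_∘_)
open import Function.Bundles using (_⇔_; mk⇔; Equivalence)
open import Function.Definitions using (Injective)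
open import Relation.Binary.PropositionalEquality
open import Relation.Nullary using (¬_; Dec; yes; no; contradiction)
open import Relation.Nullary.Decidable using (⌊_⌋)
open import Tactic.RingSolver using (solve-∀)
open import Tactic.RingSolver.Core.AlmostCommutativeRing using (AlmostCommutativeRing; fromCommutativeRing)

-- Arithmetic in F₂

F₂ : AlmostCommutativeRing _ _
F₂ = fromCommutativeRing xor-∧-commutativeRing λ { false → just refl ; true → nothing }

Bool-ext : ∀ {x y : Bool} → (x ≡ true → y ≡ true) → (y ≡ true → x ≡ true) → x ≡ y
Bool-ext {false} {false} f g = refl
Bool-ext {false} {true}  f g = g refl
Bool-ext {true}  {false} f g = sym (f refl)
Bool-ext {true}  {true}  f g = refl

∧-true⇒ : ∀ {x y} → x ∧ y ≡ true → x ≡ true × y ≡ true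
∧-true⇒ {true} {true} _ = refl , refl

∨-true⇒ : ∀ {x y} → x ∨ y ≡ true → x ≡ true ⊎ y ≡ true
∨-true⇒ {true}          _ = inj₁ refl
∨-true⇒ {false} {true}  _ = inj₂ refl

∨≡xor : ∀ x y → x ∧ y ≡ false → x ∨ y ≡ x xor y
∨≡xor false y    _ = refl
∨≡xor true false _ = refl

xor≡false⇒≡ : ∀ {x y} → x xor y ≡ false → x ≡ y
xor≡false⇒≡ {false} {false} _ = refl
xor≡false⇒≡ {true}  {true}  _ = refl

xor-telescope : ∀ x y z → (x xor y) xor (y xor z) ≡ x xor z
xor-telescope x y z = trans (regroup x y z) (cong (λ w → x xor w xor z) (xor-same y))
  where
  regroup : ∀ x y z → (x xor y) xor (y xor z) ≡ x xor (y xor y) xor z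
  regroup = solve-∀ F₂

xor-cancelˡ : ∀ x y → x xor (x xor y) ≡ y
xor-cancelˡ x y = trans (sym (xor-assoc x x y)) (cong (_xor y) (xor-same x))

infix 4 _==_
_==_ : ∀ {n} → Fin n → Fin n → Bool
a == b = ⌊ a ≟ b ⌋

==-refl : ∀ {n} (a : Fin n) → (a == a) ≡ true
==-refl a with a ≟ a
... | yes _ = refl
... | no a≢a = ⊥-elim (a≢a refl)

≡⇒== : ∀ {n} {a b : Fin n} → a ≡ b → (a == b) ≡ true
≡⇒== {a = a} refl = ==-refl a

≢⇒== : ∀ {n} {a b : Fin n} → ¬ a ≡ b → (a == b) ≡ false
≢⇒== {a = a} {b} a≢b with a ≟ b
... | yes a≡b = ⊥-elim (a≢b a≡b)
... | no _ = refl

==⇒≡ : ∀ {n} {a b : Fin n} → (a == b) ≡ true → a ≡ b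
==⇒≡ {a = a} {b} e with a ≟ b
... | yes a≡b = a≡b

==-suc : ∀ {n} (a b : Fin n) → (suc a == suc b) ≡ (a == b)
==-suc a b with a ≟ b
... | yes _ = refl
... | no _ = refl

==-sym : ∀ {n} (a b : Fin n) → (a == b) ≡ (b == a)
==-sym a b = Bool-ext (λ e → ≡⇒== (sym (==⇒≡ e))) (λ e → ≡⇒== (sym (==⇒≡ e)))

⨁ : (k : ℕ) → (Fin k → Bool) → Bool
⨁ zero    f = false
⨁ (suc k) f = f zero xor ⨁ k (λ t → f (suc t))

⨁-cong : ∀ k {f g : Fin k → Bool} → (∀ t → f t ≡ g t) → ⨁ k f ≡ ⨁ k g
⨁-cong zero    e = refl
⨁-cong (suc k) e = cong₂ _xor_ (e zero) (⨁-cong k (λ t → e (suc t)))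

⨁-zero : ∀ k {f : Fin k → Bool} → (∀ t → f t ≡ false) → ⨁ k f ≡ false
⨁-zero zero    e = refl
⨁-zero (suc k) e rewrite e zero = ⨁-zero k (λ t → e (suc t))

⨁-xor : ∀ k (f g : Fin k → Bool) → ⨁ k (λ t → f t xor g t) ≡ ⨁ k f xor ⨁ k g
⨁-xor zero    f g = refl
⨁-xor (suc k) f g = trans (cong ((f zero xor g zero) xor_) (⨁-xor k _ _))
  (swap-middle (f zero) (g zero) (⨁ k (λ t → f (suc t))) (⨁ k (λ t → g (suc t))))
  where
  swap-middle : ∀ a b c d → (a xor b) xor (c xor d) ≡ (a xor c) xor (b xor d)
  swap-middle = solve-∀ F₂

⨁-∧ˡ : ∀ k b (f : Fin k → Bool) → ⨁ k (λ t → b ∧ f t) ≡ b ∧ ⨁ k f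
⨁-∧ˡ zero    b f = sym (∧-zeroʳ b)
⨁-∧ˡ (suc k) b f = trans (cong ((b ∧ f zero) xor_) (⨁-∧ˡ k b _)) (sym (∧-distribˡ-xor b _ _))

⨁-∧ʳ : ∀ k (f : Fin k → Bool) b → ⨁ k (λ t → f t ∧ b) ≡ ⨁ k f ∧ b
⨁-∧ʳ k f b = trans (⨁-cong k (λ t → ∧-comm (f t) b)) (trans (⨁-∧ˡ k b f) (∧-comm b (⨁ k f)))

⨁-delta : ∀ k (a : Fin k) (f : Fin k → Bool) → ⨁ k (λ t → (t == a) ∧ f t) ≡ f a
⨁-delta (suc k) zero    f = trans (cong (f zero xor_) (⨁-zero k (λ _ → refl))) (xor-identityʳ (f zero))
⨁-delta (suc k) (suc a) f =
  trans (⨁-cong k (λ t → cong (_∧ f (suc t)) (==-suc t a))) (⨁-delta k a (λ t → f (suc t)))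

⨁-delta′ : ∀ k (a : Fin k) (f : Fin k → Bool) → ⨁ k (λ t → (a == t) ∧ f t) ≡ f a
⨁-delta′ k a f = trans (⨁-cong k (λ t → cong (_∧ f t) (==-sym a t))) (⨁-delta k a f)

⨁-single : ∀ k (a : Fin k) (f : Fin k → Bool) → (∀ t → ¬ t ≡ a → f t ≡ false) → ⨁ k f ≡ f a
⨁-single k a f h = trans (⨁-cong k only-a) (⨁-delta k a f)
  where
  only-a : ∀ t → f t ≡ (t == a) ∧ f t
  only-a t with t ≟ a
  ... | yes refl = refl
  ... | no t≢a = h t t≢a

⨁-true⇒ : ∀ k (f : Fin k → Bool) → ⨁ k f ≡ true → ∃[ t ] f t ≡ true
⨁-true⇒ (suc k) f e with f zero in eq
... | true = zero , eq
... | false with ⨁-true⇒ k (λ t → f (suc t)) e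
...   | t , p = suc t , p

⨁-comm : ∀ k m (f : Fin k → Fin m → Bool) →
  ⨁ k (λ s → ⨁ m (λ t → f s t)) ≡ ⨁ m (λ t → ⨁ k (λ s → f s t))
⨁-comm zero    m f = sym (⨁-zero m (λ _ → refl))
⨁-comm (suc k) m f =
  trans (cong (⨁ m (f zero) xor_) (⨁-comm k m (λ s → f (suc s)))) (sym (⨁-xor m (f zero) _))

⨁²-interchange : ∀ k m (F : Fin k → Fin k → Fin m → Fin m → Bool) →
  ⨁ k (λ i → ⨁ k (λ j → ⨁ m (λ u → ⨁ m (λ v → F i j u v)))) ≡
  ⨁ m (λ u → ⨁ m (λ v → ⨁ k (λ i → ⨁ k (λ j → F i j u v))))
⨁²-interchange k m F = begin
    ⨁ k (λ i → ⨁ k (λ j → ⨁ m (λ u → ⨁ m (λ v → F i j u v))))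
  ≡⟨ ⨁-cong k (λ i → ⨁-comm k m _) ⟩
    ⨁ k (λ i → ⨁ m (λ u → ⨁ k (λ j → ⨁ m (λ v → F i j u v))))
  ≡⟨ ⨁-comm k m _ ⟩
    ⨁ m (λ u → ⨁ k (λ i → ⨁ k (λ j → ⨁ m (λ v → F i j u v))))
  ≡⟨ ⨁-cong m (λ u → ⨁-cong k (λ i → ⨁-comm k m _)) ⟩
    ⨁ m (λ u → ⨁ k (λ i → ⨁ m (λ v → ⨁ k (λ j → F i j u v))))
  ≡⟨ ⨁-cong m (λ u → ⨁-comm k m _) ⟩
    ⨁ m (λ u → ⨁ m (λ v → ⨁ k (λ i → ⨁ k (λ j → F i j u v)))) ∎
  where open ≡-Reasoning

⨁-telescope : ∀ m (h : Fin (suc m) → Bool) →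
  ⨁ m (λ t → h (inject₁ t) xor h (suc t)) ≡ h zero xor h (fromℕ m)
⨁-telescope zero    h = sym (xor-same (h zero))
⨁-telescope (suc m) h = begin
    (h zero xor h (suc zero)) xor ⨁ m (λ t → h (suc (inject₁ t)) xor h (suc (suc t)))
  ≡⟨ cong ((h zero xor h (suc zero)) xor_) (⨁-telescope m (λ t → h (suc t))) ⟩
    (h zero xor h (suc zero)) xor (h (suc zero) xor h (suc (fromℕ m)))
  ≡⟨ xor-assoc (h zero) _ _ ⟩
    h zero xor (h (suc zero) xor (h (suc zero) xor h (suc (fromℕ m))))
  ≡⟨ cong (h zero xor_) (xor-cancelˡ (h (suc zero)) _) ⟩
    h zero xor h (suc (fromℕ m)) ∎
  where open ≡-Reasoning

-- Each unordered pair {u, v} contributes B u v xor B v u = false.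
⨁²-symmetric : ∀ k (B : Fin k → Fin k → Bool) → (∀ u v → B u v ≡ B v u) → (∀ u → B u u ≡ false) →
  ⨁ k (λ u → ⨁ k (λ v → B u v)) ≡ false
⨁²-symmetric zero    B sym-B diag-B = refl
⨁²-symmetric (suc k) B sym-B diag-B = begin
    (B zero zero xor row) xor ⨁ k (λ u → B (suc u) zero xor ⨁ k (λ v → B (suc u) (suc v)))
  ≡⟨ cong₂ (λ a b → (a xor row) xor b) (diag-B zero) (⨁-xor k _ _) ⟩
    row xor (⨁ k (λ u → B (suc u) zero) xor ⨁ k (λ u → ⨁ k (λ v → B (suc u) (suc v))))
  ≡⟨ cong₂ (λ a b → row xor (a xor b)) (⨁-cong k (λ u → sym-B (suc u) zero))
       (⨁²-symmetric k (λ u v → B (suc u) (suc v)) (λ u v → sym-B (suc u) (suc v)) (λ u → diag-B (suc u))) ⟩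
    row xor (row xor false)
  ≡⟨ xor-cancelˡ row false ⟩
    false ∎
  where
  open ≡-Reasoning
  row = ⨁ k (λ v → B zero (suc v))

anyFin≡⨁ : ∀ k (f : Fin k → Bool) → (∀ s t → f s ≡ true → f t ≡ true → s ≡ t) → anyFin k f ≡ ⨁ k f
anyFin≡⨁ zero    f at-most-one = refl
anyFin≡⨁ (suc k) f at-most-one with f zero in eq
... | true  = sym (cong not (⨁-zero k rest-false))
  where
  rest-false : ∀ t → f (suc t) ≡ false
  rest-false t = ¬-not (λ e → 0≢1+n (at-most-one zero (suc t) eq e))
... | false = anyFin≡⨁ k (λ t → f (suc t)) (λ s t p q → suc-injective (at-most-one (suc s) (suc t) p q))

anyFin-cong : ∀ k {f g : Fin k → Bool} → (∀ t → f t ≡ g t) → anyFin k f ≡ anyFin k g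
anyFin-cong zero    e = refl
anyFin-cong (suc k) e = cong₂ _∨_ (e zero) (anyFin-cong k (λ t → e (suc t)))

anyFin-false : ∀ k {f : Fin k → Bool} → (∀ t → f t ≡ false) → anyFin k f ≡ false
anyFin-false zero    e = refl
anyFin-false (suc k) e rewrite e zero = anyFin-false k (λ t → e (suc t))

anyFin-true : ∀ k (f : Fin k → Bool) t → f t ≡ true → anyFin k f ≡ true
anyFin-true (suc k) f zero    e rewrite e = refl
anyFin-true (suc k) f (suc t) e with f zero
... | true  = refl
... | false = anyFin-true k (λ t → f (suc t)) t e

anyFin-true⇒ : ∀ k (f : Fin k → Bool) → anyFin k f ≡ true → ∃[ t ] f t ≡ true
anyFin-true⇒ (suc k) f e with f zero in eq
... | true = zero , eq
... | false with anyFin-true⇒ k (λ t → f (suc t)) e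
...   | t , p = suc t , p

⨁²-delta : ∀ k (a b : Fin k) (f : Fin k → Fin k → Bool) →
  ⨁ k (λ i → ⨁ k (λ j → (i == a) ∧ ((j == b) ∧ f i j))) ≡ f a b
⨁²-delta k a b f = begin
    ⨁ k (λ i → ⨁ k (λ j → (i == a) ∧ ((j == b) ∧ f i j)))
  ≡⟨ ⨁-cong k (λ i → ⨁-∧ˡ k (i == a) _) ⟩
    ⨁ k (λ i → (i == a) ∧ ⨁ k (λ j → (j == b) ∧ f i j))
  ≡⟨ ⨁-delta k a _ ⟩
    ⨁ k (λ j → (j == b) ∧ f a j)
  ≡⟨ ⨁-delta k b _ ⟩
    f a b ∎
  where open ≡-Reasoning

⨁²-delta′ : ∀ k (a b : Fin k) (f : Fin k → Fin k → Bool) →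
  ⨁ k (λ i → ⨁ k (λ j → (a == i) ∧ ((b == j) ∧ f i j))) ≡ f a b
⨁²-delta′ k a b f = begin
    ⨁ k (λ i → ⨁ k (λ j → (a == i) ∧ ((b == j) ∧ f i j)))
  ≡⟨ ⨁-cong k (λ i → ⨁-∧ˡ k (a == i) _) ⟩
    ⨁ k (λ i → (a == i) ∧ ⨁ k (λ j → (b == j) ∧ f i j))
  ≡⟨ ⨁-delta′ k a _ ⟩
    ⨁ k (λ j → (b == j) ∧ f a j)
  ≡⟨ ⨁-delta′ k b _ ⟩
    f a b ∎
  where open ≡-Reasoning

isOdd : ℕ → Bool
isOdd zero    = false
isOdd (suc n) = not (isOdd n)

isOdd-+ : ∀ m n → isOdd (m + n) ≡ isOdd m xor isOdd n
isOdd-+ zero    n = refl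
isOdd-+ (suc m) n = trans (cong not (isOdd-+ m n)) (not-distribˡ-xor (isOdd m) (isOdd n))

isOdd-sumFin : ∀ k (f : Fin k → ℕ) → isOdd (sumFin k f) ≡ ⨁ k (λ t → isOdd (f t))
isOdd-sumFin zero    f = refl
isOdd-sumFin (suc k) f = trans (isOdd-+ (f zero) _) (cong (isOdd (f zero) xor_) (isOdd-sumFin k _))

isOdd-indicator : ∀ b → isOdd (if b then 1 else 0) ≡ b
isOdd-indicator true  = refl
isOdd-indicator false = refl

%2≡indicator : ∀ n → n % 2 ≡ (if isOdd n then 1 else 0)
%2≡indicator zero          = refl
%2≡indicator (suc zero)    = refl
%2≡indicator (suc (suc n)) =
  trans (%2≡indicator n) (cong (λ b → if b then 1 else 0) (sym (not-involutive (isOdd n))))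

even⇒¬isOdd : ∀ n → n % 2 ≡ 0 → isOdd n ≡ false
even⇒¬isOdd n e with isOdd n | %2≡indicator n
... | false | _ = refl
... | true  | p with trans (sym p) e
...   | ()

¬isOdd⇒even : ∀ n → isOdd n ≡ false → n % 2 ≡ 0
¬isOdd⇒even n e = trans (%2≡indicator n) (cong (λ b → if b then 1 else 0) e)

odd⇒isOdd : ∀ n → n % 2 ≡ 1 → isOdd n ≡ true
odd⇒isOdd n e with isOdd n | %2≡indicator n
... | true  | _ = refl
... | false | p with trans (sym p) e
...   | ()

-- Edge sets of Kₙ

infix 4 _≺_
_≺_ : ∀ {n} → Fin n → Fin n → Bool
i ≺ j = toℕ i <ᵇ toℕ j

≺-irrefl : ∀ {n} (i : Fin n) → (i ≺ i) ≡ false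
≺-irrefl zero    = refl
≺-irrefl (suc i) = ≺-irrefl i

≺⇒≢ : ∀ {n} {i j : Fin n} → (i ≺ j) ≡ true → ¬ i ≡ j
≺⇒≢ {i = i} i≺i refl with trans (sym i≺i) (≺-irrefl i)
... | ()

≺-asym : ∀ {n} (i j : Fin n) → (i ≺ j) ≡ true → (j ≺ i) ≡ false
≺-asym zero    (suc j) _   = refl
≺-asym (suc i) (suc j) i≺j = ≺-asym i j i≺j

≺-xor : ∀ {n} (i j : Fin n) → (i ≺ j) xor (j ≺ i) ≡ not (i == j)
≺-xor zero    zero    = refl
≺-xor zero    (suc j) = refl
≺-xor (suc i) zero    = refl
≺-xor (suc i) (suc j) = trans (≺-xor i j) (cong not (sym (==-suc i j)))

≺-flip : ∀ {n} {i j : Fin n} → ¬ i ≡ j → (j ≺ i) ≡ not (i ≺ j)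
≺-flip {i = i} {j} i≢j = flip (i ≺ j) (j ≺ i) (trans (≺-xor i j) (cong not (≢⇒== i≢j)))
  where
  flip : ∀ x y → x xor y ≡ true → y ≡ not x
  flip false true  _ = refl
  flip true  false _ = refl

-- Many closed forms below hold only off the diagonal; since _≈E_ only inspects
-- pairs i < j, agreement on distinct pairs is all that is needed.
infix 4 _≈≠_
_≈≠_ : ∀ {n} → EdgeSet n → EdgeSet n → Set
_≈≠_ {n} D D' = ∀ (i j : Fin n) → ¬ i ≡ j → D i j ≡ D' i j

≈≠⇒≈E : ∀ {n} {D D' : EdgeSet n} → D ≈≠ D' → D ≈E D'
≈≠⇒≈E p i j i≺j = p i j (≺⇒≢ i≺j)

≈E-trans : ∀ {n} {D D' D'' : EdgeSet n} → D ≈E D' → D' ≈E D'' → D ≈E D''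
≈E-trans p q i j i≺j = trans (p i j i≺j) (q i j i≺j)

≈E-sym : ∀ {n} {D D' : EdgeSet n} → D ≈E D' → D' ≈E D
≈E-sym p i j i≺j = sym (p i j i≺j)

⊕-cancelˡ : ∀ {n} (A B : EdgeSet n) → (A ⊕ (A ⊕ B)) ≈E B
⊕-cancelˡ A B i j _ = xor-cancelˡ (A i j) (B i j)

⨁E : ∀ {n} k → (Fin k → EdgeSet n) → EdgeSet n
⨁E k F i j = ⨁ k (λ t → F t i j)

infixr 7 _·E_
_·E_ : ∀ {n} → Bool → EdgeSet n → EdgeSet n
(b ·E D) i j = b ∧ D i j

Symmetric : ∀ {n} → EdgeSet n → Set
Symmetric {n} D = ∀ (i j : Fin n) → D i j ≡ D j i

module _ {n : ℕ} {G : EdgeSet n → Set} where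

  sumE-++ : ∀ (L L' : List (EdgeSet n)) i j → sumE (L ++ L') i j ≡ sumE L i j xor sumE L' i j
  sumE-++ []      L' i j = refl
  sumE-++ (D ∷ L) L' i j = trans (cong (D i j xor_) (sumE-++ L L' i j)) (sym (xor-assoc (D i j) _ _))

  All-++ : ∀ {L L' : List (EdgeSet n)} → All G L → All G L' → All G (L ++ L')
  All-++ []      q = q
  All-++ (x ∷ p) q = x ∷ All-++ p q

  span-emptyE : InSpan G emptyE
  span-emptyE = [] , [] , λ _ _ _ → refl

  span-generator : ∀ {D} → G D → InSpan G D
  span-generator {D} g = (D ∷ []) , (g ∷ []) , λ i j _ → xor-identityʳ (D i j)

  span-≈E : ∀ {D D'} → InSpan G D → D ≈E D' → InSpan G D'
  span-≈E (L , gens , sum≈) q = L , gens , ≈E-trans sum≈ q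

  span-⊕ : ∀ {D D'} → InSpan G D → InSpan G D' → InSpan G (D ⊕ D')
  span-⊕ (L , gens , sum≈) (L' , gens' , sum≈') = (L ++ L') , All-++ gens gens' ,
    λ i j i≺j → trans (sumE-++ L L' i j) (cong₂ _xor_ (sum≈ i j i≺j) (sum≈' i j i≺j))

  span-⨁E : ∀ k (F : Fin k → EdgeSet n) → (∀ t → InSpan G (F t)) → InSpan G (⨁E k F)
  span-⨁E zero    F h = span-emptyE
  span-⨁E (suc k) F h = span-⊕ (h zero) (span-⨁E k (λ t → F (suc t)) (λ t → h (suc t)))

  span-·E : ∀ b {D} → (b ≡ true → InSpan G D) → InSpan G (b ·E D)
  span-·E false h = span-≈E span-emptyE (λ _ _ _ → refl)
  span-·E true  h = span-≈E (h refl) (λ _ _ _ → refl)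

  span-cancel : ∀ {A B} → InSpan G A → InSpan G (A ⊕ B) → InSpan G B
  span-cancel {A} {B} a ab = span-≈E (span-⊕ a ab) (⊕-cancelˡ A B)

  span-induction : (P : EdgeSet n → Set) → P emptyE → (∀ {D D'} → P D → P D' → P (D ⊕ D')) →
    (∀ {D D'} → D ≈E D' → P D → P D') → (∀ {D} → G D → P D) → ∀ {D} → InSpan G D → P D
  span-induction P P-empty P-⊕ P-≈ P-gen (L , gens , sum≈) = P-≈ sum≈ (sum-P L gens)
    where
    sum-P : ∀ L → All G L → P (sumE L)
    sum-P []      []         = P-empty
    sum-P (D ∷ L) (g ∷ gens) = P-⊕ (P-gen g) (sum-P L gens)

∧-cong-if : ∀ b {x y} → (b ≡ true → x ≡ y) → b ∧ x ≡ b ∧ y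
∧-cong-if false h = refl
∧-cong-if true  h = h refl

parityE : ∀ {n} → EdgeSet n → Bool
parityE {n} D = ⨁ n (λ i → ⨁ n (λ j → (i ≺ j) ∧ D i j))

isOdd-sizeE : ∀ {n} (D : EdgeSet n) → isOdd (sizeE D) ≡ parityE D
isOdd-sizeE {n} D = trans (isOdd-sumFin n _)
  (⨁-cong n (λ i → trans (isOdd-sumFin n _) (⨁-cong n (λ j → isOdd-indicator _))))

InD⇔¬parityE : ∀ {n} {D : EdgeSet n} → InD D ⇔ (parityE D ≡ false)
InD⇔¬parityE {D = D} = mk⇔ (λ even → trans (sym (isOdd-sizeE D)) (even⇒¬isOdd (sizeE D) even))
                           (λ p → ¬isOdd⇒even (sizeE D) (trans (isOdd-sizeE D) p))

parityE-≈E : ∀ {n} {D D' : EdgeSet n} → D ≈E D' → parityE D ≡ parityE D'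
parityE-≈E {n} p = ⨁-cong n (λ i → ⨁-cong n (λ j → ∧-cong-if (i ≺ j) (p i j)))

parityE-⊕ : ∀ {n} (D D' : EdgeSet n) → parityE (D ⊕ D') ≡ parityE D xor parityE D'
parityE-⊕ {n} D D' =
  trans (⨁-cong n (λ i → trans (⨁-cong n (λ j → ∧-distribˡ-xor (i ≺ j) _ _)) (⨁-xor n _ _))) (⨁-xor n _ _)

parityE-emptyE : ∀ {n} → parityE (emptyE {n}) ≡ false
parityE-emptyE {n} = ⨁-zero n (λ i → ⨁-zero n (λ j → ∧-zeroʳ (i ≺ j)))

-- Only the entries at i < j are meaningful, so the degree of i reads D i j for
-- j above i and D j i for j below i.
degParity : ∀ {n} → EdgeSet n → Fin n → Bool
degParity {n} D i = ⨁ n (λ j → ((i ≺ j) ∧ D i j) xor ((j ≺ i) ∧ D j i))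

EvenDegree : ∀ {n} → EdgeSet n → Set
EvenDegree D = ∀ i → degParity D i ≡ false

evenDegree-≈E : ∀ {n} {D D' : EdgeSet n} → D ≈E D' → EvenDegree D → EvenDegree D'
evenDegree-≈E {n} p even i = trans (sym (⨁-cong n (λ j →
  cong₂ _xor_ (∧-cong-if (i ≺ j) (p i j)) (∧-cong-if (j ≺ i) (p j i))))) (even i)

degParity-⊕ : ∀ {n} (D D' : EdgeSet n) i → degParity (D ⊕ D') i ≡ degParity D i xor degParity D' i
degParity-⊕ {n} D D' i = trans (⨁-cong n (λ j → distrib (i ≺ j) (j ≺ i) (D i j) (D' i j) (D j i) (D' j i)))
  (⨁-xor n _ _)
  where
  distrib : ∀ p q x x' y y' →
    (p ∧ (x xor x')) xor (q ∧ (y xor y')) ≡ ((p ∧ x) xor (q ∧ y)) xor ((p ∧ x') xor (q ∧ y'))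
  distrib = solve-∀ F₂

evenDegree-emptyE : ∀ {n} → EvenDegree (emptyE {n})
evenDegree-emptyE {n} i = ⨁-zero n (λ j → cong₂ _xor_ (∧-zeroʳ (i ≺ j)) (∧-zeroʳ (j ≺ i)))

evenDegree-⊕ : ∀ {n} {D D' : EdgeSet n} → EvenDegree D → EvenDegree D' → EvenDegree (D ⊕ D')
evenDegree-⊕ {D = D} {D'} even even' i = trans (degParity-⊕ D D' i) (cong₂ _xor_ (even i) (even' i))

degParity-symmetric : ∀ {n} (D : EdgeSet n) → Symmetric D → ∀ i → degParity D i ≡ ⨁ n (D i) xor D i i
degParity-symmetric {n} D sym-D i = begin
    ⨁ n (λ j → ((i ≺ j) ∧ D i j) xor ((j ≺ i) ∧ D j i))
  ≡⟨ ⨁-cong n (λ j → trans (cong (((i ≺ j) ∧ D i j) xor_) (cong ((j ≺ i) ∧_) (sym-D j i)))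
       (trans (sym (∧-distribʳ-xor (D i j) (i ≺ j) (j ≺ i))) (trans (cong (_∧ D i j) (≺-xor i j))
       (not-∧ (i == j) (D i j))))) ⟩
    ⨁ n (λ j → D i j xor ((i == j) ∧ D i j))
  ≡⟨ ⨁-xor n _ _ ⟩
    ⨁ n (D i) xor ⨁ n (λ j → (i == j) ∧ D i j)
  ≡⟨ cong (⨁ n (D i) xor_) (⨁-delta′ n i (D i)) ⟩
    ⨁ n (D i) xor D i i ∎
  where
  open ≡-Reasoning
  not-∧ : ∀ e d → not e ∧ d ≡ d xor (e ∧ d)
  not-∧ false false = refl
  not-∧ false true  = refl
  not-∧ true  false = refl
  not-∧ true  true  = refl

-- Transpositions and single edges

swap : ∀ {n} → Fin n → Fin n → Fin n → Fin n
swap a b x = if x == a then b else (if x == b then a else x)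

swap-fromˡ : ∀ {n} (a b : Fin n) → swap a b a ≡ b
swap-fromˡ a b rewrite ==-refl a = refl

swap-fromʳ : ∀ {n} (a b : Fin n) → swap a b b ≡ a
swap-fromʳ a b with b ≟ a
... | yes refl = refl
... | no _ rewrite ==-refl b = refl

swap-fixed : ∀ {n} {a b x : Fin n} → ¬ x ≡ a → ¬ x ≡ b → swap a b x ≡ x
swap-fixed x≢a x≢b rewrite ≢⇒== x≢a | ≢⇒== x≢b = refl

swap-involutive : ∀ {n} (a b x : Fin n) → swap a b (swap a b x) ≡ x
swap-involutive a b x with x ≟ a
... | yes refl = swap-fromʳ x b
... | no x≢a with x ≟ b
...   | yes refl = swap-fromˡ a x
...   | no x≢b = swap-fixed x≢a x≢b

swap-injective : ∀ {n} (a b : Fin n) → Injective _≡_ _≡_ (swap a b)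
swap-injective a b {x} {y} e =
  trans (sym (swap-involutive a b x)) (trans (cong (swap a b) e) (swap-involutive a b y))

swap-== : ∀ {n} (a b x y : Fin n) → (swap a b x == y) ≡ (x == swap a b y)
swap-== a b x y = Bool-ext
  (λ e → ≡⇒== (trans (sym (swap-involutive a b x)) (cong (swap a b) (==⇒≡ e))))
  (λ e → ≡⇒== (trans (cong (swap a b) (==⇒≡ e)) (swap-involutive a b y)))

samePair-comm : ∀ {n} (a b i j : Fin n) → samePair a b i j ≡ samePair a b j i
samePair-comm a b i j = ∨-comm ((a == i) ∧ (b == j)) ((a == j) ∧ (b == i))

samePair-flip : ∀ {n} (a b i j : Fin n) → samePair a b i j ≡ samePair b a i j
samePair-flip a b i j = trans (∨-comm ((a == i) ∧ (b == j)) ((a == j) ∧ (b == i)))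
  (cong₂ _∨_ (∧-comm (a == j) (b == i)) (∧-comm (a == i) (b == j)))

samePair-swap : ∀ {n} (a b p q i j : Fin n) →
  samePair (swap a b p) (swap a b q) i j ≡ samePair p q (swap a b i) (swap a b j)
samePair-swap a b p q i j rewrite swap-== a b p i | swap-== a b q j | swap-== a b p j | swap-== a b q i = refl

samePair-suc : ∀ {n} (a b i j : Fin n) → samePair (suc a) (suc b) (suc i) (suc j) ≡ samePair a b i j
samePair-suc a b i j rewrite ==-suc a i | ==-suc b j | ==-suc a j | ==-suc b i = refl

samePair-true⇒ : ∀ {n} {a b i j : Fin n} → samePair a b i j ≡ true → (a ≡ i × b ≡ j) ⊎ (a ≡ j × b ≡ i)
samePair-true⇒ {a = a} {b} {i} {j} e with ∨-true⇒ {(a == i) ∧ (b == j)} e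
... | inj₁ p = inj₁ (==⇒≡ (proj₁ (∧-true⇒ p)) , ==⇒≡ (proj₂ (∧-true⇒ p)))
... | inj₂ p = inj₂ (==⇒≡ (proj₁ (∧-true⇒ {a == j} p)) , ==⇒≡ (proj₂ (∧-true⇒ {a == j} p)))

samePair-unique : ∀ {n} {a b a' b' i j : Fin n} → samePair a b i j ≡ true → samePair a' b' i j ≡ true →
  (a ≡ a' × b ≡ b') ⊎ (a ≡ b' × b ≡ a')
samePair-unique e e' with samePair-true⇒ e | samePair-true⇒ e'
... | inj₁ (p , q) | inj₁ (p' , q') = inj₁ (trans p (sym p') , trans q (sym q'))
... | inj₁ (p , q) | inj₂ (p' , q') = inj₂ (trans p (sym q') , trans q (sym p'))
... | inj₂ (p , q) | inj₁ (p' , q') = inj₂ (trans p (sym q') , trans q (sym p'))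
... | inj₂ (p , q) | inj₂ (p' , q') = inj₁ (trans p (sym p') , trans q (sym q'))

samePair-xor : ∀ {n} (a b i j : Fin n) → ¬ (a ≡ b × i ≡ j) →
  samePair a b i j ≡ ((a == i) ∧ (b == j)) xor ((a == j) ∧ (b == i))
samePair-xor a b i j not-loop = ∨≡xor ((a == i) ∧ (b == j)) ((a == j) ∧ (b == i)) (¬-not both)
  where
  both : ¬ ((a == i) ∧ (b == j)) ∧ ((a == j) ∧ (b == i)) ≡ true
  both e with ∧-true⇒ {(a == i) ∧ (b == j)} e
  ... | p , q with ∧-true⇒ {a == i} p | ∧-true⇒ {a == j} q
  ...   | ai , bj | aj , bi = not-loop (trans (==⇒≡ ai) (sym (==⇒≡ bi)) , trans (sym (==⇒≡ ai)) (==⇒≡ aj))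

samePair-loop : ∀ {n} (a b i : Fin n) → ¬ a ≡ b → samePair a b i i ≡ false
samePair-loop a b i a≢b = ¬-not λ e → a≢b (ends (samePair-true⇒ e))
  where
  ends : (a ≡ i × b ≡ i) ⊎ (a ≡ i × b ≡ i) → a ≡ b
  ends (inj₁ (p , q)) = trans p (sym q)
  ends (inj₂ (p , q)) = trans p (sym q)

⨁-samePair : ∀ {n} (a b i : Fin n) → ¬ a ≡ b → ⨁ n (samePair a b i) ≡ (a == i) xor (b == i)
⨁-samePair {n} a b i a≢b = begin
    ⨁ n (samePair a b i)
  ≡⟨ ⨁-cong n (λ j → samePair-xor a b i j (λ { (a≡b , _) → a≢b a≡b })) ⟩
    ⨁ n (λ j → ((a == i) ∧ (b == j)) xor ((a == j) ∧ (b == i)))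
  ≡⟨ ⨁-xor n _ _ ⟩
    ⨁ n (λ j → (a == i) ∧ (b == j)) xor ⨁ n (λ j → (a == j) ∧ (b == i))
  ≡⟨ cong₂ _xor_ (trans (⨁-∧ˡ n (a == i) _) (cong ((a == i) ∧_) b-once)) (⨁-delta′ n a (λ _ → b == i)) ⟩
    ((a == i) ∧ true) xor (b == i)
  ≡⟨ cong (_xor (b == i)) (∧-identityʳ (a == i)) ⟩
    (a == i) xor (b == i) ∎
  where
  open ≡-Reasoning
  b-once : ⨁ n (λ j → b == j) ≡ true
  b-once = trans (⨁-cong n (λ j → sym (∧-identityʳ (b == j)))) (⨁-delta′ n b (λ _ → true))

-- Copies of H

oddDegree : (H : Graph) → Fin (V H) → Bool
oddDegree H u = ⨁ (V H) (adj H u)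

isOdd-degree : ∀ H u → isOdd (degree H u) ≡ oddDegree H u
isOdd-degree H u = trans (isOdd-sumFin (V H) _) (⨁-cong (V H) (λ v → isOdd-indicator _))

isOdd-numEdges : ∀ H → isOdd (numEdges H) ≡ ⨁ (V H) (λ u → ⨁ (V H) (λ v → (u ≺ v) ∧ adj H u v))
isOdd-numEdges H = trans (isOdd-sumFin (V H) _)
  (⨁-cong (V H) (λ u → trans (isOdd-sumFin (V H) _) (⨁-cong (V H) (λ v → isOdd-indicator _))))

Eulerian⇒¬oddDegree : ∀ H → Eulerian H → ∀ u → oddDegree H u ≡ false
Eulerian⇒¬oddDegree H euler u = trans (sym (isOdd-degree H u)) (even⇒¬isOdd (degree H u) (euler u))

¬Eulerian⇒oddDegree : ∀ H → ¬ Eulerian H → ∃[ u ] oddDegree H u ≡ true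
¬Eulerian⇒oddDegree H not-euler with ¬∀⟶∃¬ (V H) _ (λ u → degree H u % 2 ℕ.≟ 0) not-euler
... | u , not-even = u , ¬-not λ e → not-even (¬isOdd⇒even (degree H u) (trans (isOdd-degree H u) e))

¬Eulerian⇒oddEdge : ∀ H → ¬ Eulerian H → ∃[ u ] ∃[ w ] oddDegree H u ≡ true × adj H u w ≡ true
¬Eulerian⇒oddEdge H not-euler with ¬Eulerian⇒oddDegree H not-euler
... | u , u-odd with ⨁-true⇒ (V H) (adj H u) u-odd
...   | w , uw = u , w , u-odd , uw

module _ (H : Graph) {n : ℕ} where

  copyOf-symmetric : ∀ (φ : Fin (V H) → Fin n) → Symmetric (copyOf H φ)
  copyOf-symmetric φ i j =
    anyFin-cong (V H) (λ u → anyFin-cong (V H) (λ v → cong (adj H u v ∧_) (samePair-comm (φ u) (φ v) i j)))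

  copyOf-swap : ∀ (φ : Fin (V H) → Fin n) (a b i j : Fin n) →
    copyOf H (λ u → swap a b (φ u)) i j ≡ copyOf H φ (swap a b i) (swap a b j)
  copyOf-swap φ a b i j =
    anyFin-cong (V H) (λ u → anyFin-cong (V H) (λ v → cong (adj H u v ∧_) (samePair-swap a b (φ u) (φ v) i j)))

  copyOf-outside : ∀ (φ : Fin (V H) → Fin n) x j → (∀ u → ¬ φ u ≡ x) → copyOf H φ x j ≡ false
  copyOf-outside φ x j x∉φ = anyFin-false (V H) (λ u → anyFin-false (V H) (λ v → ¬-not λ e →
    x∉φ-edge (samePair-true⇒ (proj₂ (∧-true⇒ {adj H u v} e)))))
    where
    x∉φ-edge : ∀ {u v} → (φ u ≡ x × φ v ≡ j) ⊎ (φ u ≡ j × φ v ≡ x) → ⊥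
    x∉φ-edge {u}     (inj₁ (p , _)) = x∉φ u p
    x∉φ-edge {u} {v} (inj₂ (_ , q)) = x∉φ v q

  module _ (φ : Fin (V H) → Fin n) (φ-inj : Injective _≡_ _≡_ φ) where

    image? : ∀ i → Dec (∃[ u ] φ u ≡ i)
    image? i = any? (λ u → φ u ≟ i)

    copyOf-image : ∀ u v → copyOf H φ (φ u) (φ v) ≡ adj H u v
    copyOf-image u v = Bool-ext to from
      where
      to : copyOf H φ (φ u) (φ v) ≡ true → adj H u v ≡ true
      to e with anyFin-true⇒ (V H) _ e
      ... | u' , e' with anyFin-true⇒ (V H) _ e'
      ... | v' , e'' with ∧-true⇒ {adj H u' v'} e''
      ... | a , s with samePair-true⇒ s
      ... | inj₁ (p , q) = subst₂ (λ x y → adj H x y ≡ true) (φ-inj p) (φ-inj q) a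
      ... | inj₂ (p , q) = trans (Graph.sym H u v) (subst₂ (λ x y → adj H x y ≡ true) (φ-inj p) (φ-inj q) a)
      from : adj H u v ≡ true → copyOf H φ (φ u) (φ v) ≡ true
      from e = anyFin-true (V H) _ u (anyFin-true (V H) _ v uv-edge)
        where
        uv-edge : adj H u v ∧ samePair (φ u) (φ v) (φ u) (φ v) ≡ true
        uv-edge rewrite e | ==-refl (φ u) | ==-refl (φ v) = refl

    copyOf-loop : ∀ i → copyOf H φ i i ≡ false
    copyOf-loop i with image? i
    ... | no i∉φ = copyOf-outside φ i i (λ u p → i∉φ (u , p))
    ... | yes (u , refl) = trans (copyOf-image u u) (Graph.irref H u)

    copyOf-expand : ∀ i j → copyOf H φ i j ≡ ⨁ (V H) (λ u → ⨁ (V H) (λ v → (φ u == i) ∧ ((φ v == j) ∧ adj H u v)))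
    copyOf-expand i j with image? i | image? j
    ... | no i∉φ | _ = trans (copyOf-outside φ i j (λ u p → i∉φ (u , p)))
      (sym (⨁-zero (V H) (λ u → ⨁-zero (V H) (λ v → cong (_∧ _) (≢⇒== (λ p → i∉φ (u , p)))))))
    ... | yes _ | no j∉φ = trans (copyOf-symmetric φ i j) (trans (copyOf-outside φ j i (λ v p → j∉φ (v , p)))
      (sym (⨁-zero (V H) (λ u → ⨁-zero (V H) (λ v →
        trans (cong (λ z → (φ u == i) ∧ (z ∧ adj H u v)) (≢⇒== (λ p → j∉φ (v , p)))) (∧-zeroʳ (φ u == i)))))))
    ... | yes (u₀ , refl) | yes (v₀ , refl) = sym (begin
        ⨁ (V H) (λ u → ⨁ (V H) (λ v → (φ u == φ u₀) ∧ ((φ v == φ v₀) ∧ adj H u v)))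
      ≡⟨ ⨁-cong (V H) (λ u → ⨁-∧ˡ (V H) (φ u == φ u₀) _) ⟩
        ⨁ (V H) (λ u → (φ u == φ u₀) ∧ ⨁ (V H) (λ v → (φ v == φ v₀) ∧ adj H u v))
      ≡⟨ ⨁-cong (V H) (λ u → cong (_∧ _) (image-== u u₀)) ⟩
        ⨁ (V H) (λ u → (u == u₀) ∧ ⨁ (V H) (λ v → (φ v == φ v₀) ∧ adj H u v))
      ≡⟨ ⨁-delta (V H) u₀ _ ⟩
        ⨁ (V H) (λ v → (φ v == φ v₀) ∧ adj H u₀ v)
      ≡⟨ ⨁-cong (V H) (λ v → cong (_∧ _) (image-== v v₀)) ⟩
        ⨁ (V H) (λ v → (v == v₀) ∧ adj H u₀ v)
      ≡⟨ ⨁-delta (V H) v₀ _ ⟩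
        adj H u₀ v₀
      ≡⟨ sym (copyOf-image u₀ v₀) ⟩
        copyOf H φ (φ u₀) (φ v₀) ∎)
      where
      open ≡-Reasoning
      image-== : ∀ u u' → (φ u == φ u') ≡ (u == u')
      image-== u u' = Bool-ext (λ e → ≡⇒== (φ-inj (==⇒≡ e))) (λ e → ≡⇒== (cong φ (==⇒≡ e)))

    ⨁-copyOf : ∀ i → ⨁ n (copyOf H φ i) ≡ ⨁ (V H) (λ u → (φ u == i) ∧ oddDegree H u)
    ⨁-copyOf i = begin
        ⨁ n (copyOf H φ i)
      ≡⟨ ⨁-cong n (copyOf-expand i) ⟩
        ⨁ n (λ j → ⨁ (V H) (λ u → ⨁ (V H) (λ v → (φ u == i) ∧ ((φ v == j) ∧ adj H u v))))
      ≡⟨ ⨁-comm n (V H) _ ⟩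
        ⨁ (V H) (λ u → ⨁ n (λ j → ⨁ (V H) (λ v → (φ u == i) ∧ ((φ v == j) ∧ adj H u v))))
      ≡⟨ ⨁-cong (V H) (λ u → ⨁-comm n (V H) _) ⟩
        ⨁ (V H) (λ u → ⨁ (V H) (λ v → ⨁ n (λ j → (φ u == i) ∧ ((φ v == j) ∧ adj H u v))))
      ≡⟨ ⨁-cong (V H) (λ u → ⨁-cong (V H) (λ v → trans (⨁-∧ˡ n (φ u == i) _)
           (cong ((φ u == i) ∧_) (⨁-delta′ n (φ v) (λ _ → adj H u v))))) ⟩
        ⨁ (V H) (λ u → ⨁ (V H) (λ v → (φ u == i) ∧ adj H u v))
      ≡⟨ ⨁-cong (V H) (λ u → ⨁-∧ˡ (V H) (φ u == i) _) ⟩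
        ⨁ (V H) (λ u → (φ u == i) ∧ oddDegree H u) ∎
      where open ≡-Reasoning

    ⨁-copyOf-image : ∀ u → ⨁ n (copyOf H φ (φ u)) ≡ oddDegree H u
    ⨁-copyOf-image u = trans (⨁-copyOf (φ u))
      (trans (⨁-single (V H) u _ (λ u' u'≢u → cong (_∧ _) (≢⇒== (λ e → u'≢u (φ-inj e)))))
             (cong (_∧ oddDegree H u) (==-refl (φ u))))

    copyOf-evenDegree : Eulerian H → EvenDegree (copyOf H φ)
    copyOf-evenDegree euler i = begin
        degParity (copyOf H φ) i
      ≡⟨ degParity-symmetric (copyOf H φ) (copyOf-symmetric φ) i ⟩
        ⨁ n (copyOf H φ i) xor copyOf H φ i i
      ≡⟨ cong₂ _xor_ (⨁-copyOf i) (copyOf-loop i) ⟩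
        ⨁ (V H) (λ u → (φ u == i) ∧ oddDegree H u) xor false
      ≡⟨ cong (_xor false) (⨁-zero (V H) (λ u →
           trans (cong ((φ u == i) ∧_) (Eulerian⇒¬oddDegree H euler u)) (∧-zeroʳ (φ u == i)))) ⟩
        false ∎
      where open ≡-Reasoning

    -- Both sides count each edge uv of H once, ordered by φ resp. by V(H); the two
    -- orders differ by a symmetric, loop-free summand.
    parityE-copyOf : parityE (copyOf H φ) ≡ isOdd (numEdges H)
    parityE-copyOf = begin
        ⨁ n (λ i → ⨁ n (λ j → (i ≺ j) ∧ copyOf H φ i j))
      ≡⟨ ⨁-cong n (λ i → ⨁-cong n (λ j → trans (cong ((i ≺ j) ∧_) (copyOf-expand i j))
           (trans (sym (⨁-∧ˡ (V H) (i ≺ j) _)) (⨁-cong (V H) (λ u → sym (⨁-∧ˡ (V H) (i ≺ j) _)))))) ⟩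
        ⨁ n (λ i → ⨁ n (λ j → ⨁ (V H) (λ u → ⨁ (V H) (λ v → summand u v i j))))
      ≡⟨ ⨁²-interchange n (V H) (λ i j u v → summand u v i j) ⟩
        ⨁ (V H) (λ u → ⨁ (V H) (λ v → ⨁ n (λ i → ⨁ n (λ j → summand u v i j))))
      ≡⟨ ⨁-cong (V H) (λ u → ⨁-cong (V H) (λ v → trans
           (⨁-cong n (λ i → ⨁-cong n (λ j → reorder (i ≺ j) (φ u == i) (φ v == j) (adj H u v))))
           (⨁²-delta′ n (φ u) (φ v) (λ i j → (i ≺ j) ∧ adj H u v)))) ⟩
        ⨁ (V H) (λ u → ⨁ (V H) (λ v → (φ u ≺ φ v) ∧ adj H u v))
      ≡⟨ xor≡false⇒≡ (trans (sym (⨁-xor (V H) _ _)) (trans (⨁-cong (V H) (λ u → sym (⨁-xor (V H) _ _)))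
           (⨁²-symmetric (V H) order-change order-change-symmetric order-change-loop))) ⟩
        ⨁ (V H) (λ u → ⨁ (V H) (λ v → (u ≺ v) ∧ adj H u v))
      ≡⟨ sym (isOdd-numEdges H) ⟩
        isOdd (numEdges H) ∎
      where
      open ≡-Reasoning
      summand : Fin (V H) → Fin (V H) → Fin n → Fin n → Bool
      summand u v i j = (i ≺ j) ∧ ((φ u == i) ∧ ((φ v == j) ∧ adj H u v))
      reorder : ∀ l x y a → l ∧ (x ∧ (y ∧ a)) ≡ x ∧ (y ∧ (l ∧ a))
      reorder = solve-∀ F₂
      order-change : Fin (V H) → Fin (V H) → Bool
      order-change u v = ((φ u ≺ φ v) ∧ adj H u v) xor ((u ≺ v) ∧ adj H u v)
      order-change-symmetric : ∀ u v → order-change u v ≡ order-change v u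
      order-change-symmetric u v with u ≟ v
      ... | yes refl = refl
      ... | no u≢v rewrite ≺-flip u≢v | ≺-flip (λ e → u≢v (φ-inj e)) | Graph.sym H v u =
        sym (not-flip (φ u ≺ φ v) (u ≺ v) (adj H u v))
        where
        not-flip : ∀ p q a → ((not p) ∧ a) xor ((not q) ∧ a) ≡ (p ∧ a) xor (q ∧ a)
        not-flip false false a = xor-same a
        not-flip false true  a = xor-identityʳ a
        not-flip true  false a = sym (xor-identityʳ a)
        not-flip true  true  a = sym (xor-same a)
      order-change-loop : ∀ u → order-change u u ≡ false
      order-change-loop u rewrite Graph.irref H u = cong₂ _xor_ (∧-zeroʳ (φ u ≺ φ u)) (∧-zeroʳ (u ≺ u))

-- Cycles, triangles and squares

module _ {n : ℕ} (k : ℕ) (c : Fin (suc (suc (suc k))) → Fin n) (c-inj : Injective _≡_ _≡_ c) where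

  private
    m : ℕ
    m = suc (suc k)

  cycleStep : Fin m → EdgeSet n
  cycleStep t = samePair (c (inject₁ t)) (c (suc t))

  cycleClosing : EdgeSet n
  cycleClosing = samePair (c (fromℕ m)) (c zero)

  private
    step-unique : ∀ i j s t → cycleStep s i j ≡ true → cycleStep t i j ≡ true → s ≡ t
    step-unique i j s t p q with samePair-unique p q
    ... | inj₁ (same , _) = inject₁-injective (c-inj same)
    ... | inj₂ (s≡t+1 , s+1≡t) = ⊥-elim (ℕ.<-irrefl refl
          (subst (toℕ t <_) t+2≡t (ℕ.m<n⇒m<1+n (ℕ.n<1+n (toℕ t)))))
      where
      t+2≡t : suc (suc (toℕ t)) ≡ toℕ t
      t+2≡t = trans (cong suc (trans (sym (cong toℕ (c-inj s≡t+1))) (toℕ-inject₁ s)))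
                    (trans (cong toℕ (c-inj s+1≡t)) (toℕ-inject₁ t))

    step-≢-closing : ∀ i j t → cycleStep t i j ≡ true → cycleClosing i j ≡ true → ⊥
    step-≢-closing i j t p q with samePair-unique p q
    ... | inj₁ (x , _) =
      ℕ.<-irrefl (trans (sym (toℕ-inject₁ t)) (trans (cong toℕ (c-inj x)) (toℕ-fromℕ m))) (toℕ<n t)
    ... | inj₂ (x , y) = 1+t≢m (trans (cong suc (trans (cong toℕ (sym (c-inj x))) (toℕ-inject₁ t)))
                                      (trans (cong toℕ (c-inj y)) (toℕ-fromℕ m)))
      where
      1+t≢m : ¬ suc zero ≡ m
      1+t≢m ()

    step-ends : ∀ t → ¬ c (inject₁ t) ≡ c (suc t)
    step-ends t e = ℕ.<-irrefl (trans (sym (toℕ-inject₁ t)) (cong toℕ (c-inj e))) (ℕ.n<1+n (toℕ t))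

    closing-ends : ¬ c (fromℕ m) ≡ c zero
    closing-ends e with trans (sym (toℕ-fromℕ m)) (cong toℕ (c-inj e))
    ... | ()

  -- The edges of an injective cycle are pairwise distinct, so their disjunction is their sum.
  cycleOf-expand : ∀ i j → cycleOf k c i j ≡ ⨁ m (λ t → cycleStep t i j) xor cycleClosing i j
  cycleOf-expand i j = trans (cong (_∨ cycleClosing i j) (anyFin≡⨁ m (λ t → cycleStep t i j) (step-unique i j)))
    (∨≡xor (⨁ m (λ t → cycleStep t i j)) (cycleClosing i j) (¬-not not-both))
    where
    not-both : ¬ ⨁ m (λ t → cycleStep t i j) ∧ cycleClosing i j ≡ true
    not-both e with ∧-true⇒ {⨁ m (λ t → cycleStep t i j)} e
    ... | p , q with ⨁-true⇒ m _ p
    ...   | t , r = step-≢-closing i j t r q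

  cycleOf-symmetric : Symmetric (cycleOf k c)
  cycleOf-symmetric i j = cong₂ _∨_ (anyFin-cong m (λ t → samePair-comm (c (inject₁ t)) (c (suc t)) i j))
                                    (samePair-comm (c (fromℕ m)) (c zero) i j)

  -- Summing the edges of the walk telescopes.
  cycleOf-evenDegree : EvenDegree (cycleOf k c)
  cycleOf-evenDegree i = begin
      degParity (cycleOf k c) i
    ≡⟨ degParity-symmetric (cycleOf k c) cycleOf-symmetric i ⟩
      ⨁ n (cycleOf k c i) xor cycleOf k c i i
    ≡⟨ cong₂ _xor_ (⨁-cong n (cycleOf-expand i)) (cycleOf-expand i i) ⟩
      ⨁ n (λ j → ⨁ m (λ t → cycleStep t i j) xor cycleClosing i j)
        xor (⨁ m (λ t → cycleStep t i i) xor cycleClosing i i)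
    ≡⟨ cong₂ _xor_ (trans (⨁-xor n _ _) (cong₂ _xor_ (⨁-comm n m (λ j t → cycleStep t i j))
                                                     (⨁-samePair (c (fromℕ m)) (c zero) i closing-ends)))
                   (cong₂ _xor_ (⨁-zero m (λ t → samePair-loop (c (inject₁ t)) (c (suc t)) i (step-ends t)))
                                (samePair-loop (c (fromℕ m)) (c zero) i closing-ends)) ⟩
      (⨁ m (λ t → ⨁ n (cycleStep t i)) xor ((c (fromℕ m) == i) xor (c zero == i))) xor false
    ≡⟨ cong (λ z → (z xor ((c (fromℕ m) == i) xor (c zero == i))) xor false)
         (trans (⨁-cong m (λ t → ⨁-samePair (c (inject₁ t)) (c (suc t)) i (step-ends t)))
                (⨁-telescope m (λ s → c s == i))) ⟩
      (((c zero == i) xor (c (fromℕ m) == i)) xor ((c (fromℕ m) == i) xor (c zero == i))) xor false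
    ≡⟨ cancel (c zero == i) (c (fromℕ m) == i) ⟩
      false ∎
    where
    open ≡-Reasoning
    cancel : ∀ a b → ((a xor b) xor (b xor a)) xor false ≡ false
    cancel false false = refl
    cancel false true  = refl
    cancel true  false = refl
    cancel true  true  = refl

Distinct3 : ∀ {n} → Fin n → Fin n → Fin n → Set
Distinct3 a b c = ¬ a ≡ b × ¬ b ≡ c × ¬ a ≡ c

record Distinct4 {n} (a w b c : Fin n) : Set where
  constructor distinct4
  field
    a≢w : ¬ a ≡ w
    a≢b : ¬ a ≡ b
    a≢c : ¬ a ≡ c
    w≢b : ¬ w ≡ b
    w≢c : ¬ w ≡ c
    b≢c : ¬ b ≡ c

vertices3 : ∀ {n} → Fin n → Fin n → Fin n → Fin 3 → Fin n
vertices3 a b c zero             = a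
vertices3 a b c (suc zero)       = b
vertices3 a b c (suc (suc zero)) = c

vertices3-injective : ∀ {n} {a b c : Fin n} → Distinct3 a b c → Injective _≡_ _≡_ (vertices3 a b c)
vertices3-injective (a≢b , b≢c , a≢c) {x} {y} = go x y
  where
  go : ∀ x y → vertices3 _ _ _ x ≡ vertices3 _ _ _ y → x ≡ y
  go zero             zero             e = refl
  go zero             (suc zero)       e = ⊥-elim (a≢b e)
  go zero             (suc (suc zero)) e = ⊥-elim (a≢c e)
  go (suc zero)       zero             e = ⊥-elim (a≢b (sym e))
  go (suc zero)       (suc zero)       e = refl
  go (suc zero)       (suc (suc zero)) e = ⊥-elim (b≢c e)
  go (suc (suc zero)) zero             e = ⊥-elim (a≢c (sym e))
  go (suc (suc zero)) (suc zero)       e = ⊥-elim (b≢c (sym e))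
  go (suc (suc zero)) (suc (suc zero)) e = refl

vertices4 : ∀ {n} → Fin n → Fin n → Fin n → Fin n → Fin 4 → Fin n
vertices4 a w b c zero                   = a
vertices4 a w b c (suc zero)             = w
vertices4 a w b c (suc (suc zero))       = b
vertices4 a w b c (suc (suc (suc zero))) = c

vertices4-injective : ∀ {n} {a w b c : Fin n} → Distinct4 a w b c → Injective _≡_ _≡_ (vertices4 a w b c)
vertices4-injective d {x} {y} = go x y
  where
  open Distinct4 d
  go : ∀ x y → vertices4 _ _ _ _ x ≡ vertices4 _ _ _ _ y → x ≡ y
  go zero                   zero                   e = refl
  go zero                   (suc zero)             e = ⊥-elim (a≢w e)
  go zero                   (suc (suc zero))       e = ⊥-elim (a≢b e)
  go zero                   (suc (suc (suc zero))) e = ⊥-elim (a≢c e)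
  go (suc zero)             zero                   e = ⊥-elim (a≢w (sym e))
  go (suc zero)             (suc zero)             e = refl
  go (suc zero)             (suc (suc zero))       e = ⊥-elim (w≢b e)
  go (suc zero)             (suc (suc (suc zero))) e = ⊥-elim (w≢c e)
  go (suc (suc zero))       zero                   e = ⊥-elim (a≢b (sym e))
  go (suc (suc zero))       (suc zero)             e = ⊥-elim (w≢b (sym e))
  go (suc (suc zero))       (suc (suc zero))       e = refl
  go (suc (suc zero))       (suc (suc (suc zero))) e = ⊥-elim (b≢c e)
  go (suc (suc (suc zero))) zero                   e = ⊥-elim (a≢c (sym e))
  go (suc (suc (suc zero))) (suc zero)             e = ⊥-elim (w≢c (sym e))
  go (suc (suc (suc zero))) (suc (suc zero))       e = ⊥-elim (b≢c (sym e))
  go (suc (suc (suc zero))) (suc (suc (suc zero))) e = refl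

triangle : ∀ {n} → Fin n → Fin n → Fin n → EdgeSet n
triangle a b c = cycleOf 0 (vertices3 a b c)

square : ∀ {n} → Fin n → Fin n → Fin n → Fin n → EdgeSet n
square a w b c = cycleOf 1 (vertices4 a w b c)

triangle-isCycle : ∀ {n} {a b c : Fin n} → Distinct3 a b c → IsCycle (triangle a b c)
triangle-isCycle d = 0 , vertices3 _ _ _ , vertices3-injective d , λ _ _ _ → refl

triangle-expand : ∀ {n} {a b c : Fin n} → Distinct3 a b c → ∀ i j →
  triangle a b c i j ≡ samePair a b i j xor samePair b c i j xor samePair c a i j
triangle-expand {a = a} {b} {c} d i j = trans (cycleOf-expand 0 (vertices3 a b c) (vertices3-injective d) i j)
  (regroup (samePair a b i j) (samePair b c i j) (samePair c a i j))
  where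
  regroup : ∀ x y z → (x xor y xor false) xor z ≡ x xor y xor z
  regroup = solve-∀ F₂

square-expand : ∀ {n} {a w b c : Fin n} → Distinct4 a w b c → ∀ i j →
  square a w b c i j ≡ samePair a w i j xor samePair w b i j xor samePair b c i j xor samePair c a i j
square-expand {a = a} {w} {b} {c} d i j = trans (cycleOf-expand 1 (vertices4 a w b c) (vertices4-injective d) i j)
  (regroup (samePair a w i j) (samePair w b i j) (samePair b c i j) (samePair c a i j))
  where
  regroup : ∀ x y z t → (x xor y xor z xor false) xor t ≡ x xor y xor z xor t
  regroup = solve-∀ F₂

triangle-⊕-triangle : ∀ {n} {x z y w : Fin n} → Distinct4 x z y w → ∀ i j →
  (triangle x y z ⊕ triangle x y w) i j ≡ square x z y w i j
triangle-⊕-triangle {x = x} {z} {y} {w} d i j = begin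
    triangle x y z i j xor triangle x y w i j
  ≡⟨ cong₂ _xor_ (triangle-expand (a≢b , ≢-sym w≢b , a≢w) i j) (triangle-expand (a≢b , b≢c , a≢c) i j) ⟩
    (xy xor yz xor zx) xor (xy xor yw xor wx)
  ≡⟨ trans (regroup xy yz zx yw wx) (cong (_xor (zx xor yz xor yw xor wx)) (xor-same xy)) ⟩
    false xor zx xor yz xor yw xor wx
  ≡⟨ cong₂ (λ p q → p xor q xor yw xor wx) (samePair-flip z x i j) (samePair-flip y z i j) ⟩
    samePair x z i j xor samePair z y i j xor yw xor wx
  ≡⟨ sym (square-expand d i j) ⟩
    square x z y w i j ∎
  where
  open ≡-Reasoning
  open Distinct4 d
  xy = samePair x y i j
  yz = samePair y z i j
  zx = samePair z x i j
  yw = samePair y w i j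
  wx = samePair w x i j
  regroup : ∀ p q r s t → (p xor q xor r) xor (p xor s xor t) ≡ (p xor p) xor r xor q xor s xor t
  regroup = solve-∀ F₂

triangle-rotate : ∀ {n} {x y z : Fin n} → Distinct3 x y z → ∀ i j → triangle x y z i j ≡ triangle x z y i j
triangle-rotate {x = x} {y} {z} d@(x≢y , y≢z , x≢z) i j = begin
    triangle x y z i j
  ≡⟨ triangle-expand d i j ⟩
    samePair x y i j xor samePair y z i j xor samePair z x i j
  ≡⟨ reorder (samePair x y i j) (samePair y z i j) (samePair z x i j) ⟩
    samePair z x i j xor samePair y z i j xor samePair x y i j
  ≡⟨ cong₂ (λ p q → p xor q xor samePair x y i j) (samePair-flip z x i j)
       (samePair-flip y z i j) ⟩
    samePair x z i j xor samePair z y i j xor samePair x y i j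
  ≡⟨ cong (λ p → samePair x z i j xor samePair z y i j xor p) (samePair-flip x y i j) ⟩
    samePair x z i j xor samePair z y i j xor samePair y x i j
  ≡⟨ sym (triangle-expand (x≢z , ≢-sym y≢z , x≢y) i j) ⟩
    triangle x z y i j ∎
  where
  open ≡-Reasoning
  reorder : ∀ p q r → p xor q xor r ≡ r xor q xor p
  reorder = solve-∀ F₂

-- Decompositions of an edge set

⨁²E : ∀ {n} m → (Fin m → Fin m → Bool) → (Fin m → Fin m → EdgeSet n) → EdgeSet n
⨁²E m b A = ⨁E m (λ i → ⨁E m (λ j → b i j ·E A i j))

⨁² : ∀ m → (Fin m → Fin m → Bool) → Bool
⨁² m b = ⨁ m (λ i → ⨁ m (b i))

⨁²E-rebase : ∀ {n} m (b : Fin m → Fin m → Bool) (A : Fin m → Fin m → EdgeSet n) (B : EdgeSet n) →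
  ⨁²E m b A ≈E (⨁²E m b (λ i j → A i j ⊕ B) ⊕ (⨁² m b ·E B))
⨁²E-rebase m b A B p q _ = sym (begin
    ⨁ m (λ i → ⨁ m (λ j → b i j ∧ (A i j p q xor B p q))) xor (⨁² m b ∧ B p q)
  ≡⟨ cong (_xor (⨁² m b ∧ B p q)) (trans
       (⨁-cong m (λ i → trans (⨁-cong m (λ j → ∧-distribˡ-xor (b i j) (A i j p q) (B p q))) (⨁-xor m _ _)))
       (⨁-xor m _ _)) ⟩
    (⨁E m (λ i → ⨁E m (λ j → b i j ·E A i j)) p q xor ⨁ m (λ i → ⨁ m (λ j → b i j ∧ B p q)))
      xor (⨁² m b ∧ B p q)
  ≡⟨ cong (λ z → (⨁²E m b A p q xor z) xor (⨁² m b ∧ B p q))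
       (trans (⨁-cong m (λ i → ⨁-∧ʳ m (b i) (B p q))) (⨁-∧ʳ m _ (B p q))) ⟩
    (⨁²E m b A p q xor (⨁² m b ∧ B p q)) xor (⨁² m b ∧ B p q)
  ≡⟨ trans (xor-assoc (⨁²E m b A p q) _ _)
       (trans (cong (⨁²E m b A p q xor_) (xor-same (⨁² m b ∧ B p q))) (xor-identityʳ _)) ⟩
    ⨁²E m b A p q ∎)
  where open ≡-Reasoning

span-⨁²E : ∀ {n} {G : EdgeSet n → Set} m b (A : Fin m → Fin m → EdgeSet n) →
  (∀ i j → b i j ≡ true → InSpan G (A i j)) → InSpan G (⨁²E m b A)
span-⨁²E m b A h = span-⨁E m _ (λ i → span-⨁E m _ (λ j → span-·E (b i j) (h i j)))

-- Each summand A i j is congruent to B modulo the span, so the whole combination is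
-- congruent to B taken ⨁² m b times.
span-⨁²E-via : ∀ {n} {G : EdgeSet n → Set} m b (A : Fin m → Fin m → EdgeSet n) (B : EdgeSet n) →
  (∀ i j → b i j ≡ true → InSpan G (A i j ⊕ B)) → (⨁² m b ≡ true → InSpan G B) → InSpan G (⨁²E m b A)
span-⨁²E-via m b A B summands base =
  span-≈E (span-⊕ (span-⨁²E m b _ summands) (span-·E (⨁² m b) base)) (≈E-sym (⨁²E-rebase m b A B))

-- For p ≺ q only the summand i = p, j = q of the edge decomposition sees the pair pq.
⨁²-samePair : ∀ {n} (F : Fin n → Fin n → Bool) (p q : Fin n) → (p ≺ q) ≡ true →
  ⨁ n (λ i → ⨁ n (λ j → ((i ≺ j) ∧ F i j) ∧ samePair i j p q)) ≡ F p q
⨁²-samePair {n} F p q p≺q = begin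
    ⨁ n (λ i → ⨁ n (λ j → ((i ≺ j) ∧ F i j) ∧ samePair i j p q))
  ≡⟨ ⨁-cong n (λ i → ⨁-cong n (λ j → trans
       (cong (((i ≺ j) ∧ F i j) ∧_) (samePair-xor i j p q (λ { (_ , p≡q) → ≺⇒≢ p≺q p≡q })))
       (distrib ((i ≺ j) ∧ F i j) (i == p) (j == q) (i == q) (j == p)))) ⟩
    ⨁ n (λ i → ⨁ n (λ j → ((i == p) ∧ ((j == q) ∧ ((i ≺ j) ∧ F i j))) xor
                          ((i == q) ∧ ((j == p) ∧ ((i ≺ j) ∧ F i j)))))
  ≡⟨ trans (⨁-cong n (λ i → ⨁-xor n _ _)) (⨁-xor n _ _) ⟩
    ⨁ n (λ i → ⨁ n (λ j → (i == p) ∧ ((j == q) ∧ ((i ≺ j) ∧ F i j)))) xor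
    ⨁ n (λ i → ⨁ n (λ j → (i == q) ∧ ((j == p) ∧ ((i ≺ j) ∧ F i j))))
  ≡⟨ cong₂ _xor_ (⨁²-delta n p q (λ i j → (i ≺ j) ∧ F i j)) (⨁²-delta n q p (λ i j → (i ≺ j) ∧ F i j)) ⟩
    ((p ≺ q) ∧ F p q) xor ((q ≺ p) ∧ F q p)
  ≡⟨ cong₂ (λ x y → (x ∧ F p q) xor (y ∧ F q p)) p≺q (≺-asym p q p≺q) ⟩
    F p q xor false
  ≡⟨ xor-identityʳ (F p q) ⟩
    F p q ∎
  where
  open ≡-Reasoning
  distrib : ∀ f x y u v → f ∧ ((x ∧ y) xor (u ∧ v)) ≡ (x ∧ (y ∧ f)) xor (u ∧ (v ∧ f))
  distrib = solve-∀ F₂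

samePair-transpose : ∀ {n} (a b i j : Fin n) → samePair a b i j ≡ samePair i j a b
samePair-transpose a b i j rewrite ==-sym a i | ==-sym b j | ==-sym a j | ==-sym b i =
  cong ((i == a) ∧ (j == b) ∨_) (∧-comm (j == a) (i == b))

parityE-samePair-≺ : ∀ {n} (a b : Fin n) → (a ≺ b) ≡ true → parityE (samePair a b) ≡ true
parityE-samePair-≺ {n} a b a≺b = trans
  (⨁-cong n (λ i → ⨁-cong n (λ j → cong₂ _∧_ (sym (∧-identityʳ (i ≺ j))) (samePair-transpose a b i j))))
  (⨁²-samePair (λ _ _ → true) a b a≺b)

parityE-samePair : ∀ {n} {a b : Fin n} → ¬ a ≡ b → parityE (samePair a b) ≡ true
parityE-samePair {n} {a} {b} a≢b with a ≺ b in a≺b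
... | true  = parityE-samePair-≺ a b a≺b
... | false = trans (⨁-cong n (λ i → ⨁-cong n (λ j → cong ((i ≺ j) ∧_) (samePair-flip a b i j))))
                    (parityE-samePair-≺ b a (trans (≺-flip a≢b) (cong not a≺b)))

parityE-triangle : ∀ {n} {a b c : Fin n} → Distinct3 a b c → parityE (triangle a b c) ≡ true
parityE-triangle {a = a} {b} {c} d@(a≢b , b≢c , a≢c) = begin
    parityE (triangle a b c)
  ≡⟨ parityE-≈E (λ i j _ → triangle-expand d i j) ⟩
    parityE (samePair a b ⊕ (samePair b c ⊕ samePair c a))
  ≡⟨ trans (parityE-⊕ (samePair a b) (samePair b c ⊕ samePair c a))
           (cong (parityE (samePair a b) xor_) (parityE-⊕ (samePair b c) (samePair c a))) ⟩
    parityE (samePair a b) xor parityE (samePair b c) xor parityE (samePair c a)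
  ≡⟨ cong₂ _xor_ (parityE-samePair a≢b) (cong₂ _xor_ (parityE-samePair b≢c) (parityE-samePair (≢-sym a≢c))) ⟩
    true ∎
  where open ≡-Reasoning

edge-decomposition : ∀ {n} (D : EdgeSet n) → D ≈E ⨁²E n (λ i j → (i ≺ j) ∧ D i j) samePair
edge-decomposition D p q p≺q = sym (⨁²-samePair D p q p≺q)

module _ {m : ℕ} (D : EdgeSet (suc m)) (even : EvenDegree D) where

  -- D restricted to the vertices other than zero, whose triangles with zero make up D.
  fan : Fin m → Fin m → Bool
  fan i j = (i ≺ j) ∧ D (suc i) (suc j)

  fan-distinct : ∀ {i j} → fan i j ≡ true → Distinct3 {suc m} zero (suc i) (suc j)
  fan-distinct e = (λ ()) , (λ x → ≺⇒≢ (proj₁ (∧-true⇒ e)) (suc-injective x)) , (λ ())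

  private
    fan-triangle-at-zero : ∀ q i j →
      fan i j ∧ triangle zero (suc i) (suc j) zero (suc q) ≡ (fan i j ∧ (i == q)) xor (fan i j ∧ (j == q))
    fan-triangle-at-zero q i j with fan i j in e
    ... | false = refl
    ... | true = trans (triangle-expand (fan-distinct e) zero (suc q))
                       (trans (simplify (suc i == suc q) (suc j == suc q)) (cong₂ _xor_ (==-suc i q) (==-suc j q)))
      where
      simplify : ∀ x y → (x ∨ false) xor (x ∧ false) xor (y ∧ true) ≡ x xor y
      simplify false y = ∧-identityʳ y
      simplify true  y = cong not (∧-identityʳ y)

    fan-triangle-off-zero : ∀ p q i j →
      fan i j ∧ triangle zero (suc i) (suc j) (suc p) (suc q) ≡ fan i j ∧ samePair i j p q
    fan-triangle-off-zero p q i j with fan i j in e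
    ... | false = refl
    ... | true = trans (triangle-expand (fan-distinct e) (suc p) (suc q))
                       (trans (simplify (samePair (suc i) (suc j) (suc p) (suc q)) (suc j == suc p) (suc j == suc q))
                              (samePair-suc i j p q))
      where
      simplify : ∀ s x y → false xor s xor ((x ∧ false) ∨ (y ∧ false)) ≡ s
      simplify s x y rewrite ∧-zeroʳ x | ∧-zeroʳ y = xor-identityʳ s

  -- The edges at zero are forced by the even degrees at the other vertices.
  triangle-decomposition : D ≈E ⨁²E m fan (λ i j → triangle zero (suc i) (suc j))
  triangle-decomposition zero    zero    ()
  triangle-decomposition (suc p) zero    ()
  triangle-decomposition zero    (suc q) _ = begin
      D zero (suc q)
    ≡⟨ xor≡false⇒≡ (even (suc q)) ⟩
      ⨁ m (λ j → fan q j xor fan j q)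
    ≡⟨ ⨁-xor m (fan q) (λ j → fan j q) ⟩
      ⨁ m (fan q) xor ⨁ m (λ j → fan j q)
    ≡⟨ cong₂ _xor_ (sym row) (sym column) ⟩
      ⨁ m (λ i → ⨁ m (λ j → fan i j ∧ (i == q))) xor ⨁ m (λ i → ⨁ m (λ j → fan i j ∧ (j == q)))
    ≡⟨ sym (trans (⨁-cong m (λ i → ⨁-xor m _ _)) (⨁-xor m _ _)) ⟩
      ⨁ m (λ i → ⨁ m (λ j → (fan i j ∧ (i == q)) xor (fan i j ∧ (j == q))))
    ≡⟨ sym (⨁-cong m (λ i → ⨁-cong m (λ j → fan-triangle-at-zero q i j))) ⟩
      ⨁²E m fan (λ i j → triangle zero (suc i) (suc j)) zero (suc q) ∎
    where
    open ≡-Reasoning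
    row : ⨁ m (λ i → ⨁ m (λ j → fan i j ∧ (i == q))) ≡ ⨁ m (fan q)
    row = trans (⨁-cong m (λ i → trans (⨁-∧ʳ m (fan i) (i == q)) (∧-comm _ (i == q))))
                (⨁-delta m q (λ i → ⨁ m (fan i)))
    column : ⨁ m (λ i → ⨁ m (λ j → fan i j ∧ (j == q))) ≡ ⨁ m (λ j → fan j q)
    column = trans (⨁-comm m m _) (trans (⨁-cong m (λ j → trans (⨁-∧ʳ m (λ i → fan i j) (j == q))
                   (∧-comm _ (j == q)))) (⨁-delta m q (λ j → ⨁ m (λ i → fan i j))))
  triangle-decomposition (suc p) (suc q) p≺q =
    sym (trans (⨁-cong m (λ i → ⨁-cong m (λ j → fan-triangle-off-zero p q i j)))
               (⨁²-samePair (λ i j → D (suc i) (suc j)) p q p≺q))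

  -- The edges at zero are counted by the degree parity at zero.
  parityE-fan : parityE D ≡ ⨁² m fan
  parityE-fan = cong (_xor ⨁² m fan) (trans (⨁-cong m (λ j → sym (xor-identityʳ (D zero (suc j))))) (even zero))

-- The cycle space and the invariants of the span of copies

InC⇔EvenDegree : ∀ {m} {D : EdgeSet (suc m)} → InC D ⇔ EvenDegree D
InC⇔EvenDegree {m} {D} = mk⇔
  (span-induction EvenDegree evenDegree-emptyE (λ {D} {D'} → evenDegree-⊕ {D = D} {D'}) evenDegree-≈E
    (λ { (k , c , c-inj , c≈) → evenDegree-≈E c≈ (cycleOf-evenDegree k c c-inj) }))
  (λ even → span-≈E (span-⨁²E m (fan D even) _ (λ i j e → span-generator (triangle-isCycle (fan-distinct D even e))))
                    (≈E-sym (triangle-decomposition D even)))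

span-evenDegree : ∀ {m} {G : EdgeSet (suc m) → Set} (B : EdgeSet (suc m)) →
  (∀ i j → (i ≺ j) ≡ true → InSpan G (triangle zero (suc i) (suc j) ⊕ B)) →
  ∀ {D} → EvenDegree D → (parityE D ≡ true → InSpan G B) → InSpan G D
span-evenDegree {m} B triangles {D} even base =
  span-≈E (span-⨁²E-via m (fan D even) _ B (λ i j e → triangles i j (proj₁ (∧-true⇒ e)))
                        (λ odd → base (trans (parityE-fan D even) odd)))
          (≈E-sym (triangle-decomposition D even))

span-all : ∀ {n} {G : EdgeSet n → Set} (B : EdgeSet n) →
  (∀ i j → (i ≺ j) ≡ true → InSpan G (samePair i j ⊕ B)) →
  ∀ D → (parityE D ≡ true → InSpan G B) → InSpan G D
span-all {n} B edges D base =
  span-≈E (span-⨁²E-via n (λ i j → (i ≺ j) ∧ D i j) samePair B (λ i j e → edges i j (proj₁ (∧-true⇒ e))) base)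
          (≈E-sym (edge-decomposition D))

module _ (H : Graph) {n : ℕ} where

  InCH-parityE : isOdd (numEdges H) ≡ false → ∀ {D : EdgeSet n} → InCH H D → parityE D ≡ false
  InCH-parityE H-even = span-induction (λ D → parityE D ≡ false) (parityE-emptyE {n})
    (λ {D} {D'} p q → trans (parityE-⊕ D D') (cong₂ _xor_ p q))
    (λ D≈ p → trans (sym (parityE-≈E D≈)) p)
    (λ { (φ , φ-inj , φ≈) → trans (sym (parityE-≈E φ≈)) (trans (parityE-copyOf H φ φ-inj) H-even) })

  InCH-evenDegree : Eulerian H → ∀ {D : EdgeSet n} → InCH H D → EvenDegree D
  InCH-evenDegree euler = span-induction EvenDegree evenDegree-emptyE (λ {D} {D'} → evenDegree-⊕ {D = D} {D'})
    evenDegree-≈E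
    (λ { (φ , φ-inj , φ≈) → evenDegree-≈E φ≈ (copyOf-evenDegree H φ φ-inj euler) })

-- Moving a star

-- twinStars a b N is the star from a to the vertices of N plus the star from b to them.
twinStars : ∀ {n} → Fin n → Fin n → (Fin n → Bool) → EdgeSet n
twinStars a b N i j = (((a == i) xor (b == i)) ∧ N j) xor (((a == j) xor (b == j)) ∧ N i)

twinStars-⊕ : ∀ {n} (a b : Fin n) N N' i j →
  (twinStars a b N ⊕ twinStars a b N') i j ≡ twinStars a b (λ x → N x xor N' x) i j
twinStars-⊕ a b N N' i j = distrib ((a == i) xor (b == i)) ((a == j) xor (b == j)) (N j) (N i) (N' j) (N' i)
  where
  distrib : ∀ s t x y x' y' →
    ((s ∧ x) xor (t ∧ y)) xor ((s ∧ x') xor (t ∧ y')) ≡ (s ∧ (x xor x')) xor (t ∧ (y xor y'))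
  distrib = solve-∀ F₂

⨁E-twinStars : ∀ {n} k (a b : Fin n) (f : Fin k → Bool) (F : Fin k → Fin n → Bool) i j →
  ⨁E k (λ t → f t ·E twinStars a b (F t)) i j ≡ twinStars a b (λ x → ⨁ k (λ t → f t ∧ F t x)) i j
⨁E-twinStars k a b f F i j = begin
    ⨁ k (λ t → f t ∧ ((s ∧ F t j) xor (s′ ∧ F t i)))
  ≡⟨ ⨁-cong k (λ t → distrib (f t) s (F t j) s′ (F t i)) ⟩
    ⨁ k (λ t → (s ∧ (f t ∧ F t j)) xor (s′ ∧ (f t ∧ F t i)))
  ≡⟨ ⨁-xor k _ _ ⟩
    ⨁ k (λ t → s ∧ (f t ∧ F t j)) xor ⨁ k (λ t → s′ ∧ (f t ∧ F t i))
  ≡⟨ cong₂ _xor_ (⨁-∧ˡ k s _) (⨁-∧ˡ k s′ _) ⟩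
    (s ∧ ⨁ k (λ t → f t ∧ F t j)) xor (s′ ∧ ⨁ k (λ t → f t ∧ F t i)) ∎
  where
  open ≡-Reasoning
  s = (a == i) xor (b == i)
  s′ = (a == j) xor (b == j)
  distrib : ∀ f s x s′ y → f ∧ ((s ∧ x) xor (s′ ∧ y)) ≡ (s ∧ (f ∧ x)) xor (s′ ∧ (f ∧ y))
  distrib = solve-∀ F₂

-- If b is isolated in Y, transposing a and b moves the star at a over to b.
⊕-swap-isolated : ∀ {n} (Y : EdgeSet n) → Symmetric Y → (∀ x → Y x x ≡ false) → ∀ {a b : Fin n} → ¬ a ≡ b →
  (∀ j → Y b j ≡ false) → (Y ⊕ (λ i j → Y (swap a b i) (swap a b j))) ≈≠ twinStars a b (Y a)
⊕-swap-isolated Y sym-Y loop-Y {a} {b} a≢b b-isolated i j i≢j with i ≟ a | i ≟ b | j ≟ a | j ≟ b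
... | yes refl | yes refl | _        | _        = ⊥-elim (a≢b refl)
... | _        | _        | yes refl | yes refl = ⊥-elim (a≢b refl)
... | yes refl | _        | yes refl | _        = ⊥-elim (i≢j refl)
... | _        | yes refl | _        | yes refl = ⊥-elim (i≢j refl)
... | yes refl | no _     | no _     | yes refl
  rewrite ==-refl i | ==-refl j | ≢⇒== a≢b | ≢⇒== (≢-sym a≢b)
        | loop-Y i | b-isolated i | sym-Y i j | b-isolated i = refl
... | no _     | yes refl | yes refl | no _
  rewrite ==-refl i | ==-refl j | ≢⇒== a≢b | ≢⇒== (≢-sym a≢b)
        | loop-Y j | b-isolated j | sym-Y j i | b-isolated j = refl
... | yes refl | no _     | no j≢a   | no j≢b
  rewrite ==-refl i | ≢⇒== (≢-sym a≢b)
        | ≢⇒== (≢-sym j≢a) | ≢⇒== (≢-sym j≢b) | b-isolated j = refl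
... | no i≢a   | yes refl | no j≢a   | no j≢b
  rewrite ==-refl i | ≢⇒== a≢b
        | ≢⇒== (≢-sym j≢a) | ≢⇒== (≢-sym j≢b) | b-isolated j = sym (xor-identityʳ _)
... | no i≢a   | no i≢b   | yes refl | no _
  rewrite ==-refl j | ≢⇒== (≢-sym a≢b)
        | ≢⇒== (≢-sym i≢a) | ≢⇒== (≢-sym i≢b) | sym-Y i b | b-isolated i | sym-Y i j = xor-identityʳ _
... | no i≢a   | no i≢b   | no _     | yes refl
  rewrite ==-refl j | ≢⇒== a≢b
        | ≢⇒== (≢-sym i≢a) | ≢⇒== (≢-sym i≢b) | sym-Y i b | b-isolated i | sym-Y i a = refl
... | no i≢a   | no i≢b   | no j≢a   | no j≢b
  rewrite ≢⇒== (≢-sym i≢a) | ≢⇒== (≢-sym i≢b)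
        | ≢⇒== (≢-sym j≢a) | ≢⇒== (≢-sym j≢b) = xor-same (Y i j)

square≈≠twinStars : ∀ {n} {a w b c : Fin n} → Distinct4 a w b c →
  square a w b c ≈≠ twinStars a b (λ x → (w == x) xor (c == x))
square≈≠twinStars {a = a} {w} {b} {c} d i j i≢j =
  trans (square-expand d i j)
    (trans (cong₂ _xor_ (expand a w) (cong₂ _xor_ (expand w b) (cong₂ _xor_ (expand b c) (expand c a))))
           (regroup (a == i) (b == i) (w == i) (c == i) (a == j) (b == j) (w == j) (c == j)))
  where
  expand : ∀ x y → samePair x y i j ≡ ((x == i) ∧ (y == j)) xor ((x == j) ∧ (y == i))
  expand x y = samePair-xor x y i j (i≢j ∘ proj₂)
  regroup : ∀ ai bi wi ci aj bj wj cj →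
    ((ai ∧ wj) xor (aj ∧ wi)) xor ((wi ∧ bj) xor (wj ∧ bi)) xor
    ((bi ∧ cj) xor (bj ∧ ci)) xor ((ci ∧ aj) xor (cj ∧ ai))
    ≡ ((ai xor bi) ∧ (wj xor cj)) xor ((aj xor bj) ∧ (wi xor ci))
  regroup = solve-∀ F₂

path≈≠twinStars : ∀ {n} (x y z : Fin n) → (samePair x y ⊕ samePair y z) ≈≠ twinStars x z (y ==_)
path≈≠twinStars x y z i j i≢j =
  trans (cong₂ _xor_ (samePair-xor x y i j (i≢j ∘ proj₂)) (samePair-xor y z i j (i≢j ∘ proj₂)))
        (regroup (x == i) (x == j) (y == i) (y == j) (z == i) (z == j))
  where
  regroup : ∀ xi xj yi yj zi zj →
    ((xi ∧ yj) xor (xj ∧ yi)) xor ((yi ∧ zj) xor (yj ∧ zi)) ≡ ((xi xor zi) ∧ yj) xor ((xj xor zj) ∧ yi)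
  regroup = solve-∀ F₂

-- Placing H in Kₙ

redirect : ∀ {n} → (Fin n → Fin n) → Fin n → Fin n → Fin n → Fin n
redirect ρ p q x = swap (ρ p) q (ρ x)

redirect-hit : ∀ {n} (ρ : Fin n → Fin n) p q → redirect ρ p q p ≡ q
redirect-hit ρ p q = swap-fromˡ (ρ p) q

redirect-keep : ∀ {n} {ρ : Fin n → Fin n} → Injective _≡_ _≡_ ρ → ∀ {p q x y} →
  ρ x ≡ y → ¬ x ≡ p → ¬ y ≡ q → redirect ρ p q x ≡ y
redirect-keep {ρ = ρ} ρ-inj {p} {q} ρx≡y x≢p y≢q =
  trans (cong (swap (ρ p) q) ρx≡y) (swap-fixed (λ y≡ρp → x≢p (ρ-inj (trans ρx≡y y≡ρp))) y≢q)

redirect-injective : ∀ {n} {ρ : Fin n → Fin n} → Injective _≡_ _≡_ ρ → ∀ p q → Injective _≡_ _≡_ (redirect ρ p q)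
redirect-injective {ρ = ρ} ρ-inj p q e = ρ-inj (swap-injective (ρ p) q e)

record Embedding (H : Graph) (n : ℕ) (u₀ w₀ : Fin (V H)) (a w : Fin n) (Avoided : Fin n → Set) : Set where
  field
    φ : Fin (V H) → Fin n
    injective : Injective _≡_ _≡_ φ
    maps-u₀ : φ u₀ ≡ a
    maps-w₀ : φ w₀ ≡ w
    avoids : ∀ {x} → Avoided x → ∀ u → ¬ φ u ≡ x

-- H is placed on its first V(H) vertices, with two spare vertices, and then moved
-- into position by transpositions.
module _ (H : Graph) {n : ℕ} (room : suc (suc (V H)) ≤ n) {u₀ w₀ : Fin (V H)} (u₀≢w₀ : ¬ u₀ ≡ w₀) where

  private
    V≤n : V H ≤ n
    V≤n = ℕ.≤-trans (ℕ.n≤1+n _) (ℕ.≤-trans (ℕ.n≤1+n _) room)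

    ι : Fin (V H) → Fin n
    ι u = inject≤ u V≤n

    ι-injective : Injective _≡_ _≡_ ι
    ι-injective {x} {y} = inject≤-injective V≤n V≤n x y

    spare₁ spare₂ : Fin n
    spare₁ = fromℕ< (ℕ.≤-trans (ℕ.n≤1+n _) room)
    spare₂ = fromℕ< room

    ι≢spare₁ : ∀ u → ¬ ι u ≡ spare₁
    ι≢spare₁ u e = ℕ.<-irrefl (trans (sym (toℕ-inject≤ u V≤n)) (trans (cong toℕ e) (toℕ-fromℕ< _))) (toℕ<n u)

    ι≢spare₂ : ∀ u → ¬ ι u ≡ spare₂
    ι≢spare₂ u e = ℕ.<-irrefl (trans (sym (toℕ-inject≤ u V≤n)) (trans (cong toℕ e) (toℕ-fromℕ< _)))
                              (ℕ.m<n⇒m<1+n (toℕ<n u))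

    spare₁≢spare₂ : ¬ spare₁ ≡ spare₂
    spare₁≢spare₂ e = ℕ.1+n≢n (sym (trans (sym (toℕ-fromℕ< _)) (trans (cong toℕ e) (toℕ-fromℕ< _))))

  module _ {a w b : Fin n} (a≢w : ¬ a ≡ w) (a≢b : ¬ a ≡ b) (w≢b : ¬ w ≡ b) where

    private
      ρ₁ ρ₂ ρ₃ : Fin n → Fin n
      ρ₁ = redirect (λ x → x) (ι u₀) a
      ρ₂ = redirect ρ₁ (ι w₀) w
      ρ₃ = redirect ρ₂ spare₁ b

      ρ₁-injective : Injective _≡_ _≡_ ρ₁
      ρ₁-injective = redirect-injective (λ e → e) (ι u₀) a
      ρ₂-injective : Injective _≡_ _≡_ ρ₂
      ρ₂-injective = redirect-injective ρ₁-injective (ι w₀) w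
      ρ₃-injective : Injective _≡_ _≡_ ρ₃
      ρ₃-injective = redirect-injective ρ₂-injective spare₁ b

      ρ₂-u₀ : ρ₂ (ι u₀) ≡ a
      ρ₂-u₀ = redirect-keep ρ₁-injective (redirect-hit (λ x → x) (ι u₀) a) (u₀≢w₀ ∘ ι-injective) a≢w
      ρ₃-u₀ : ρ₃ (ι u₀) ≡ a
      ρ₃-u₀ = redirect-keep ρ₂-injective ρ₂-u₀ (ι≢spare₁ u₀) a≢b
      ρ₃-w₀ : ρ₃ (ι w₀) ≡ w
      ρ₃-w₀ = redirect-keep ρ₂-injective (redirect-hit ρ₁ (ι w₀) w) (ι≢spare₁ w₀) w≢b
      ρ₃-spare₁ : ρ₃ spare₁ ≡ b
      ρ₃-spare₁ = redirect-hit ρ₂ spare₁ b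

    embedding-avoiding : Embedding H n u₀ w₀ a w (_≡ b)
    embedding-avoiding = record
      { φ = λ u → ρ₃ (ι u)
      ; injective = λ e → ι-injective (ρ₃-injective e)
      ; maps-u₀ = ρ₃-u₀
      ; maps-w₀ = ρ₃-w₀
      ; avoids = λ { refl u e → ι≢spare₁ u (ρ₃-injective (trans e (sym ρ₃-spare₁))) }
      }

    embedding-avoiding₂ : ∀ {c} → ¬ a ≡ c → ¬ w ≡ c → ¬ b ≡ c →
      Embedding H n u₀ w₀ a w (λ x → x ≡ b ⊎ x ≡ c)
    embedding-avoiding₂ {c} a≢c w≢c b≢c = record
      { φ = λ u → ρ₄ (ι u)
      ; injective = λ e → ι-injective (ρ₄-injective e)
      ; maps-u₀ = redirect-keep ρ₃-injective ρ₃-u₀ (ι≢spare₂ u₀) a≢c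
      ; maps-w₀ = redirect-keep ρ₃-injective ρ₃-w₀ (ι≢spare₂ w₀) w≢c
      ; avoids = λ { (inj₁ refl) u e → ι≢spare₁ u (ρ₄-injective (trans e (sym ρ₄-spare₁)))
                   ; (inj₂ refl) u e → ι≢spare₂ u (ρ₄-injective (trans e (sym ρ₄-spare₂))) }
      }
      where
      ρ₄ : Fin n → Fin n
      ρ₄ = redirect ρ₃ spare₂ c
      ρ₄-injective : Injective _≡_ _≡_ ρ₄
      ρ₄-injective = redirect-injective ρ₃-injective spare₂ c
      ρ₄-spare₁ : ρ₄ spare₁ ≡ b
      ρ₄-spare₁ = redirect-keep ρ₃-injective ρ₃-spare₁ spare₁≢spare₂ b≢c
      ρ₄-spare₂ : ρ₄ spare₂ ≡ c
      ρ₄-spare₂ = redirect-hit ρ₃ spare₂ c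

-- Squares and paths of length two in the span of the copies of H

oddSet-⊕-pairs : ∀ {k} (N : Fin k → Bool) (y : Fin k) → ⨁ k N ≡ true → N y ≡ true →
  ∀ v → N v xor ⨁ k (λ w → (N w ∧ not (w == y)) ∧ ((w == v) xor (y == v))) ≡ (y == v)
oddSet-⊕-pairs {k} N y N-odd N-y v = begin
    N v xor ⨁ k (λ w → M w ∧ ((w == v) xor (y == v)))
  ≡⟨ cong (N v xor_) (trans (⨁-cong k (λ w → ∧-distribˡ-xor (M w) (w == v) (y == v)))
       (trans (⨁-xor k _ _) (cong₂ _xor_ (⨁-cong k (λ w → ∧-comm (M w) (w == v))) (⨁-∧ʳ k M (y == v))))) ⟩
    N v xor (⨁ k (λ w → (w == v) ∧ M w) xor (⨁ k M ∧ (y == v)))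
  ≡⟨ cong₂ (λ p q → N v xor (p xor (q ∧ (y == v)))) (⨁-delta k v M) M-even ⟩
    N v xor (M v xor false)
  ≡⟨ cong (N v xor_) (xor-identityʳ (M v)) ⟩
    N v xor M v
  ≡⟨ only-y ⟩
    (y == v) ∎
  where
  open ≡-Reasoning
  M : Fin k → Bool
  M w = N w ∧ not (w == y)
  M-even : ⨁ k M ≡ false
  M-even = trans (⨁-cong k (λ w → split (N w) (w == y)))
           (trans (⨁-xor k N (λ w → (w == y) ∧ N w)) (cong₂ _xor_ N-odd (trans (⨁-delta k y N) N-y)))
    where
    split : ∀ a e → a ∧ not e ≡ a xor (e ∧ a)
    split false e     = sym (∧-zeroʳ e)
    split true  false = refl
    split true  true  = refl
  only-y : N v xor M v ≡ (y == v)
  only-y with v ≟ y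
  ... | yes refl rewrite N-y | ==-refl v = refl
  ... | no v≢y rewrite ≢⇒== (≢-sym v≢y) = trans (cong (N v xor_) (∧-identityʳ (N v))) (xor-same (N v))

twinStars-cong : ∀ {n} (a b : Fin n) {N N' : Fin n → Bool} → (∀ x → N x ≡ N' x) →
  ∀ i j → twinStars a b N i j ≡ twinStars a b N' i j
twinStars-cong a b N≡N' i j = cong₂ (λ x y → (((a == i) xor (b == i)) ∧ x) xor (((a == j) xor (b == j)) ∧ y))
                                    (N≡N' j) (N≡N' i)

swap-difference : ∀ {n} (N : Fin n → Bool) {w c : Fin n} → N w ≡ true → N c ≡ false →
  ∀ x → N x xor N (swap w c x) ≡ (w == x) xor (c == x)
swap-difference N {w} {c} Nw Nc x with x ≟ w | x ≟ c
... | yes refl | yes refl = ⊥-elim (not-¬ Nc Nw)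
... | yes refl | no x≢c rewrite Nw | Nc | ==-refl x | ≢⇒== (≢-sym x≢c) = refl
... | no x≢w | yes refl rewrite Nw | Nc | ==-refl x | ≢⇒== (≢-sym x≢w) = refl
... | no x≢w | no x≢c rewrite ≢⇒== (≢-sym x≢w) | ≢⇒== (≢-sym x≢c) = xor-same (N x)

module _ (H : Graph) {n : ℕ} where

  copyOf-inCH : ∀ {φ : Fin (V H) → Fin n} → Injective _≡_ _≡_ φ → InCH H (copyOf H φ)
  copyOf-inCH {φ} φ-inj = span-generator (φ , (λ {x} {y} → φ-inj {x} {y}) , λ _ _ _ → refl)

  embedding-edge : ∀ {u₀ w₀ a w A} (E : Embedding H n u₀ w₀ a w A) → adj H u₀ w₀ ≡ true →
    copyOf H (Embedding.φ E) a w ≡ true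
  embedding-edge {u₀} {w₀} E u₀w₀ =
    trans (cong₂ (copyOf H φ) (sym maps-u₀) (sym maps-w₀)) (trans (copyOf-image H φ injective u₀ w₀) u₀w₀)
    where open Embedding E

  swap∘-injective : ∀ {φ : Fin (V H) → Fin n} → Injective _≡_ _≡_ φ → ∀ a b →
    Injective _≡_ _≡_ (λ u → swap a b (φ u))
  swap∘-injective φ-inj a b e = φ-inj (swap-injective a b e)

  copyOf-⊕-swap : ∀ (φ : Fin (V H) → Fin n) → Injective _≡_ _≡_ φ → ∀ {a b} → ¬ a ≡ b → (∀ u → ¬ φ u ≡ b) →
    (copyOf H φ ⊕ copyOf H (λ u → swap a b (φ u))) ≈≠ twinStars a b (copyOf H φ a)
  copyOf-⊕-swap φ φ-inj {a} {b} a≢b b∉φ i j i≢j =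
    trans (cong (copyOf H φ i j xor_) (copyOf-swap H φ a b i j))
      (⊕-swap-isolated (copyOf H φ) (copyOf-symmetric H φ) (copyOf-loop H φ φ-inj) a≢b
        (λ j → copyOf-outside H φ b j b∉φ) i j i≢j)

  -- Transposing a b and w c independently gives four copies of H whose sum is the
  -- square a w b c, provided φ maps an edge of H onto aw and avoids b and c.
  square-inCH : ∀ {u₀ w₀ a w b c} → adj H u₀ w₀ ≡ true → Distinct4 a w b c →
    Embedding H n u₀ w₀ a w (λ x → x ≡ b ⊎ x ≡ c) → InCH H (square a w b c)
  square-inCH {u₀} {w₀} {a} {w} {b} {c} u₀w₀ d E = span-≈E
    (span-⊕ (span-⊕ (copyOf-inCH φ-inj) (copyOf-inCH (swap∘-injective φ-inj a b)))
            (span-⊕ (copyOf-inCH τφ-inj) (copyOf-inCH (swap∘-injective τφ-inj a b))))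
    (≈≠⇒≈E four-copies)
    where
    open Distinct4 d
    open Embedding E renaming (injective to φ-inj)
    τφ : Fin (V H) → Fin n
    τφ u = swap w c (φ u)
    τφ-inj : Injective _≡_ _≡_ τφ
    τφ-inj = swap∘-injective φ-inj w c
    b∉φ : ∀ u → ¬ φ u ≡ b
    b∉φ = avoids (inj₁ refl)
    b∉τφ : ∀ u → ¬ τφ u ≡ b
    b∉τφ u e = b∉φ u (trans (sym (swap-involutive w c (φ u))) (trans (cong (swap w c) e)
                 (swap-fixed (≢-sym w≢b) b≢c)))
    N : Fin n → Bool
    N = copyOf H φ a
    N-w : N w ≡ true
    N-w = embedding-edge E u₀w₀
    N-c : N c ≡ false
    N-c = trans (copyOf-symmetric H φ a c) (copyOf-outside H φ c a (avoids (inj₂ refl)))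
    neighbourhoods : ∀ x → N x xor copyOf H τφ a x ≡ (w == x) xor (c == x)
    neighbourhoods x = trans (cong (N x xor_) (trans (copyOf-swap H φ w c a x)
                         (cong (λ y → copyOf H φ y (swap w c x)) (swap-fixed a≢w a≢c))))
                       (swap-difference N N-w N-c x)
    four-copies : ((copyOf H φ ⊕ copyOf H (λ u → swap a b (φ u))) ⊕
                   (copyOf H τφ ⊕ copyOf H (λ u → swap a b (τφ u)))) ≈≠ square a w b c
    four-copies i j i≢j = begin
        (copyOf H φ i j xor copyOf H (λ u → swap a b (φ u)) i j) xor
        (copyOf H τφ i j xor copyOf H (λ u → swap a b (τφ u)) i j)
      ≡⟨ cong₂ _xor_ (copyOf-⊕-swap φ φ-inj a≢b b∉φ i j i≢j) (copyOf-⊕-swap τφ τφ-inj a≢b b∉τφ i j i≢j) ⟩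
        (twinStars a b N ⊕ twinStars a b (copyOf H τφ a)) i j
      ≡⟨ twinStars-⊕ a b N (copyOf H τφ a) i j ⟩
        twinStars a b (λ x → N x xor copyOf H τφ a x) i j
      ≡⟨ twinStars-cong a b neighbourhoods i j ⟩
        twinStars a b (λ x → (w == x) xor (c == x)) i j
      ≡⟨ sym (square≈≠twinStars d i j i≢j) ⟩
        square a w b c i j ∎
      where open ≡-Reasoning

  -- The copy and its image under the transposition of x and z move the odd star at x
  -- over to z; the squares x w z y over the other neighbours w of x cancel all of it
  -- except the path x y z.
  path-inCH : ∀ {u₀ w₀ x y z} → oddDegree H u₀ ≡ true → Distinct3 x y z →
    Embedding H n u₀ w₀ x y (_≡ z) → adj H u₀ w₀ ≡ true →
    (∀ {a w b c : Fin n} → Distinct4 a w b c → InCH H (square a w b c)) → InCH H (samePair x y ⊕ samePair y z)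
  path-inCH {u₀} {w₀} {x} {y} {z} u₀-odd (x≢y , y≢z , x≢z) E u₀w₀ squares = span-≈E
    (span-⊕ (span-⊕ (copyOf-inCH φ-inj) (copyOf-inCH (swap∘-injective φ-inj x z)))
            (span-⨁E n _ (λ w → span-·E (M w) (λ m → squares (distinct m)))))
    (≈≠⇒≈E copies-and-squares)
    where
    open Embedding E renaming (injective to φ-inj)
    N M : Fin n → Bool
    N = copyOf H φ x
    M w = N w ∧ not (w == y)
    N-x : N x ≡ false
    N-x = copyOf-loop H φ φ-inj x
    N-z : N z ≡ false
    N-z = trans (copyOf-symmetric H φ x z) (copyOf-outside H φ z x (avoids refl))
    N-y : N y ≡ true
    N-y = embedding-edge E u₀w₀
    distinct : ∀ {w} → M w ≡ true → Distinct4 x w z y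
    distinct {w} m = record
      { a≢w = λ { refl → not-¬ N-x (proj₁ (∧-true⇒ {N w} m)) }
      ; a≢b = x≢z
      ; a≢c = x≢y
      ; w≢b = λ { refl → not-¬ N-z (proj₁ (∧-true⇒ {N w} m)) }
      ; w≢c = λ { refl → not-¬ (cong not (==-refl w)) (proj₂ (∧-true⇒ {N w} m)) }
      ; b≢c = ≢-sym y≢z
      }
    N-odd : ⨁ n N ≡ true
    N-odd = trans (cong (λ a → ⨁ n (copyOf H φ a)) (sym maps-u₀)) (trans (⨁-copyOf-image H φ φ-inj u₀) u₀-odd)
    copies-and-squares : ((copyOf H φ ⊕ copyOf H (λ u → swap x z (φ u))) ⊕ ⨁E n (λ w → M w ·E square x w z y))
                         ≈≠ (samePair x y ⊕ samePair y z)
    copies-and-squares i j i≢j = begin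
        (copyOf H φ i j xor copyOf H (λ u → swap x z (φ u)) i j) xor ⨁ n (λ w → M w ∧ square x w z y i j)
      ≡⟨ cong₂ _xor_ (copyOf-⊕-swap φ φ-inj x≢z (avoids refl) i j i≢j)
           (⨁-cong n (λ w → ∧-cong-if (M w) (λ m → square≈≠twinStars (distinct m) i j i≢j))) ⟩
        twinStars x z N i j xor ⨁E n (λ w → M w ·E twinStars x z (λ v → (w == v) xor (y == v))) i j
      ≡⟨ cong (twinStars x z N i j xor_) (⨁E-twinStars n x z M (λ w v → (w == v) xor (y == v)) i j) ⟩
        (twinStars x z N ⊕ twinStars x z (λ v → ⨁ n (λ w → M w ∧ ((w == v) xor (y == v))))) i j
      ≡⟨ twinStars-⊕ x z N _ i j ⟩
        twinStars x z (λ v → N v xor ⨁ n (λ w → M w ∧ ((w == v) xor (y == v)))) i j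
      ≡⟨ twinStars-cong x z (oddSet-⊕-pairs N y N-odd N-y) i j ⟩
        twinStars x z (y ==_) i j
      ≡⟨ sym (path≈≠twinStars x y z i j i≢j) ⟩
        (samePair x y ⊕ samePair y z) i j ∎
      where open ≡-Reasoning

-- Reduction to a single triangle or a single edge

module _ {m : ℕ} {G : EdgeSet (suc (suc (suc m))) → Set}
         (squares : ∀ {a w b c} → Distinct4 a w b c → InSpan G (square a w b c)) where

  private
    v₁ v₂ : Fin (suc (suc (suc m)))
    v₁ = suc zero
    v₂ = suc (suc zero)

    t₀ : EdgeSet (suc (suc (suc m)))
    t₀ = triangle zero v₁ v₂

    triangle-step : ∀ {x z y w} → Distinct4 x z y w → InSpan G (triangle x y z ⊕ triangle x y w)
    triangle-step d = span-≈E (squares d) (λ i j _ → sym (triangle-⊕-triangle d i j))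

  -- Triangles through zero are linked to the base triangle 012 by at most two steps.
  triangle-⊕-triangle₀ : ∀ i j → (i ≺ j) ≡ true →
    InSpan G (triangle zero (suc i) (suc j) ⊕ triangle zero (suc zero) (suc (suc zero)))
  triangle-⊕-triangle₀ zero (suc zero) _ = span-≈E span-emptyE (λ p q _ → sym (xor-same (t₀ p q)))
  triangle-⊕-triangle₀ zero (suc (suc j)) _ =
    triangle-step {zero} {suc (suc (suc j))} {v₁} {v₂} (distinct4 (λ ()) (λ ()) (λ ()) (λ ()) (λ ()) (λ ()))
  triangle-⊕-triangle₀ (suc zero) (suc (suc j)) _ =
    span-≈E (triangle-step {zero} {suc (suc (suc j))} {v₂} {v₁}
              (distinct4 (λ ()) (λ ()) (λ ()) (λ ()) (λ ()) (λ ())))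
      (λ p q _ → cong (triangle zero v₂ (suc (suc (suc j))) p q xor_)
                      (triangle-rotate {x = zero} {v₂} {v₁} ((λ ()) , (λ ()) , (λ ())) p q))
  triangle-⊕-triangle₀ (suc (suc i)) (suc (suc j)) i≺j =
    span-≈E (span-⊕
        (triangle-step {zero} {b} {a} {v₁} (distinct4 (λ ()) (λ ()) (λ ()) (≢-sym distinct-ends) (λ ()) (λ ())))
        (triangle-step {zero} {a} {v₁} {v₂} (distinct4 (λ ()) (λ ()) (λ ()) (λ ()) (λ ()) (λ ()))))
      (λ p q _ → trans (cong ((triangle zero a b p q xor triangle zero a v₁ p q) xor_)
                              (cong (_xor t₀ p q) (triangle-rotate {x = zero} {v₁} {a} ((λ ()) , (λ ()) , (λ ())) p q)))
                       (xor-telescope (triangle zero a b p q) (triangle zero a v₁ p q) (t₀ p q)))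
    where
    a b : Fin (suc (suc (suc m)))
    a = suc (suc (suc i))
    b = suc (suc (suc j))
    distinct-ends : ¬ a ≡ b
    distinct-ends e = ≺⇒≢ {i = i} i≺j (suc-injective (suc-injective (suc-injective e)))

module _ {k : ℕ} {G : EdgeSet (suc (suc k)) → Set}
         (paths : ∀ {x y z} → Distinct3 x y z → InSpan G (samePair x y ⊕ samePair y z)) where

  private
    e₀ : EdgeSet (suc (suc k))
    e₀ = samePair zero (suc zero)

  edge-⊕-edge₀ : ∀ i j → (i ≺ j) ≡ true → InSpan G (samePair i j ⊕ samePair zero (suc zero))
  edge-⊕-edge₀ zero    zero          ()
  edge-⊕-edge₀ (suc i) zero          ()
  edge-⊕-edge₀ (suc i) (suc zero)    ()
  edge-⊕-edge₀ zero    (suc zero)    _ = span-≈E span-emptyE (λ p q _ → sym (xor-same (e₀ p q)))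
  edge-⊕-edge₀ zero    (suc (suc j)) _ =
    span-≈E (paths {suc (suc j)} {zero} {suc zero} ((λ ()) , (λ ()) , (λ ())))
      (λ p q _ → cong (_xor e₀ p q) (samePair-flip (suc (suc j)) zero p q))
  edge-⊕-edge₀ (suc i) (suc (suc j)) i≺j =
    span-≈E (span-⊕ (paths {a} {b} {zero} (a≢b , (λ ()) , (λ ())))
                    (paths {b} {zero} {suc zero} ((λ ()) , (λ ()) , (λ ()))))
      (λ p q _ → xor-telescope (samePair a b p q) (samePair b zero p q) (e₀ p q))
    where
    a b : Fin (suc (suc k))
    a = suc i
    b = suc (suc j)
    a≢b : ¬ a ≡ b
    a≢b = ≺⇒≢ {i = a} {b} i≺j
-- The four cases

module _ (H : Graph) {m : ℕ} (room : suc (suc (V H)) ≤ suc (suc (suc m))) where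

  private
    n : ℕ
    n = suc (suc (suc m))

    triangle₀ edge₀ : EdgeSet n
    triangle₀ = triangle zero (suc zero) (suc (suc zero))
    edge₀ = samePair zero (suc zero)

    triangle₀-distinct : Distinct3 {n} zero (suc zero) (suc (suc zero))
    triangle₀-distinct = (λ ()) , (λ ()) , (λ ())

  module _ {u₀ w₀ : Fin (V H)} (u₀w₀ : adj H u₀ w₀ ≡ true) where

    private
      u₀≢w₀ : ¬ u₀ ≡ w₀
      u₀≢w₀ refl = not-¬ (Graph.irref H u₀) u₀w₀

      squares : ∀ {a w b c : Fin n} → Distinct4 a w b c → InCH H (square a w b c)
      squares d = square-inCH H u₀w₀ d (embedding-avoiding₂ H room u₀≢w₀ a≢w a≢b w≢b a≢c w≢c b≢c)
        where open Distinct4 d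

      E₀ : Embedding H n u₀ w₀ zero (suc zero) (_≡ suc (suc zero))
      E₀ = embedding-avoiding H room u₀≢w₀ (λ ()) (λ ()) (λ ())

      copy₀ : EdgeSet n
      copy₀ = copyOf H (Embedding.φ E₀)

      copy₀-inCH : InCH H copy₀
      copy₀-inCH = copyOf-inCH H (Embedding.injective E₀)

      parityE-copy₀ : parityE copy₀ ≡ isOdd (numEdges H)
      parityE-copy₀ = parityE-copyOf H (Embedding.φ E₀) (Embedding.injective E₀)

      evenDegree-inCH : ∀ {D} → EvenDegree D → (parityE D ≡ true → InCH H triangle₀) → InCH H D
      evenDegree-inCH = span-evenDegree triangle₀ (triangle-⊕-triangle₀ squares)

      -- copy₀ ⊕ triangle₀ has even degrees and even size.
      triangle₀-inCH : Eulerian H → numEdges H % 2 ≡ 1 → InCH H triangle₀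
      triangle₀-inCH euler odd = span-cancel copy₀-inCH (evenDegree-inCH
        (evenDegree-⊕ {D = copy₀} {triangle₀} (copyOf-evenDegree H _ (Embedding.injective E₀) euler)
           (Equivalence.to (InC⇔EvenDegree {D = triangle₀}) (span-generator (triangle-isCycle triangle₀-distinct))))
        (λ odd-parity → contradiction odd-parity (not-¬ parity)))
        where
        parity : parityE (copy₀ ⊕ triangle₀) ≡ false
        parity = trans (parityE-⊕ copy₀ triangle₀)
          (cong₂ _xor_ (trans parityE-copy₀ (odd⇒isOdd (numEdges H) odd)) (parityE-triangle triangle₀-distinct))

    InCH⇔InC : Eulerian H → numEdges H % 2 ≡ 1 → ∀ (D : EdgeSet n) → InCH H D ⇔ InC D
    InCH⇔InC euler odd D = mk⇔
      (λ D∈ → Equivalence.from (InC⇔EvenDegree {D = D}) (InCH-evenDegree H euler D∈))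
      (λ D∈ → evenDegree-inCH (Equivalence.to (InC⇔EvenDegree {D = D}) D∈) (λ _ → triangle₀-inCH euler odd))

    InCH⇔InC×InD : Eulerian H → numEdges H % 2 ≡ 0 → ∀ (D : EdgeSet n) → InCH H D ⇔ (InC D × InD D)
    InCH⇔InC×InD euler even D = mk⇔
      (λ D∈ → Equivalence.from (InC⇔EvenDegree {D = D}) (InCH-evenDegree H euler D∈) ,
              Equivalence.from (InD⇔¬parityE {D = D}) (InCH-parityE H (even⇒¬isOdd (numEdges H) even) D∈))
      (λ { (D∈C , D∈D) → evenDegree-inCH (Equivalence.to (InC⇔EvenDegree {D = D}) D∈C)
                           (λ odd-parity → contradiction odd-parity (not-¬ (Equivalence.to (InD⇔¬parityE {D = D}) D∈D))) })

    module _ (u₀-odd : oddDegree H u₀ ≡ true) where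

      private
        paths : ∀ {x y z : Fin n} → Distinct3 x y z → InCH H (samePair x y ⊕ samePair y z)
        paths d@(x≢y , y≢z , x≢z) = path-inCH H u₀-odd d (embedding-avoiding H room u₀≢w₀ x≢y x≢z y≢z) u₀w₀ squares

        any-inCH : ∀ D → (parityE D ≡ true → InCH H edge₀) → InCH H D
        any-inCH = span-all edge₀ (edge-⊕-edge₀ paths)

      InCH⇔⊤ : numEdges H % 2 ≡ 1 → ∀ (D : EdgeSet n) → InCH H D ⇔ ⊤
      InCH⇔⊤ odd D = mk⇔ (λ _ → tt) (λ _ → any-inCH D (λ _ → edge₀-inCH))
        where
        parity : parityE (copy₀ ⊕ edge₀) ≡ false
        parity = trans (parityE-⊕ copy₀ edge₀)
          (cong₂ _xor_ (trans parityE-copy₀ (odd⇒isOdd (numEdges H) odd)) (parityE-samePair-≺ {n} zero (suc zero) refl))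
        edge₀-inCH : InCH H edge₀
        edge₀-inCH = span-cancel copy₀-inCH
          (any-inCH (copy₀ ⊕ edge₀) (λ odd-parity → contradiction odd-parity (not-¬ parity)))

      InCH⇔InD : numEdges H % 2 ≡ 0 → ∀ (D : EdgeSet n) → InCH H D ⇔ InD D
      InCH⇔InD even D = mk⇔
        (λ D∈ → Equivalence.from (InD⇔¬parityE {D = D}) (InCH-parityE H (even⇒¬isOdd (numEdges H) even) D∈))
        (λ D∈D → any-inCH D (λ odd-parity → contradiction odd-parity (not-¬ (Equivalence.to (InD⇔¬parityE {D = D}) D∈D))))

theorem1p5 : (H : Graph) → HasEdge H →
    ∃[ N ] ∀ (n : ℕ) → n ≥ N →
      ((Eulerian H → numEdges H % 2 ≡ 1 →
          ∀ (D : EdgeSet n) → InCH H D ⇔ InC D)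
      × (Eulerian H → numEdges H % 2 ≡ 0 →
          ∀ (D : EdgeSet n) → InCH H D ⇔ (InC D × InD D))
      × (¬ Eulerian H → numEdges H % 2 ≡ 1 →
          ∀ (D : EdgeSet n) → InCH H D ⇔ ⊤)
      × (¬ Eulerian H → numEdges H % 2 ≡ 0 →
          ∀ (D : EdgeSet n) → InCH H D ⇔ InD D))
theorem1p5 H (u , v , uv) = suc (suc (suc (V H))) , cases
  where
  cases : ∀ n → n ≥ suc (suc (suc (V H))) → _
  cases (suc (suc (suc m))) (s≤s (s≤s (s≤s V≤m))) =
      InCH⇔InC H room uv
    , InCH⇔InC×InD H room uv
    , (λ not-euler → let (_ , _ , u₀-odd , u₀w₀) = ¬Eulerian⇒oddEdge H not-euler
                      in InCH⇔⊤ H room u₀w₀ u₀-odd)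
    , (λ not-euler → let (_ , _ , u₀-odd , u₀w₀) = ¬Eulerian⇒oddEdge H not-euler
                      in InCH⇔InD H room u₀w₀ u₀-odd)
    where
    room : suc (suc (V H)) ≤ suc (suc (suc m))
    room = s≤s (s≤s (ℕ.m≤n⇒m≤1+n V≤m))
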